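{- Assume the Fan Theorem (for decidable bars). Then every enumerable positive coherent theory $\mathbb{T}$ is complete with respect to enumerable model diagrams: every positive coherent sequent over the signature of $\mathbb{T}$ which is true in all enumerable $\mathbb{T}$-model diagrams is provable in $\mathbb{T}$.
   Context: The metatheory is IZF. A signature is a set of relation symbols with finite arities (single-sorted, no function symbols, containing $=$). Sequents $\phi\vdash_{\mathbf{x}}\psi$ express $\forall\mathbf{x}(\phi\to\psi)$; deduction is intuitionistic free logic. Positive coherent formulas are built from atomic formulas using $\top,\wedge,\vee,\exists$; a positive coherent theory is a set of positive coherent sequents. A set is enumerable if it is a semi-decidable subset $\{a\in A:\exists n\,f(a)(n)=1\}$ of a countable set $A$ (for some $f:A\to 2^{\mathbb{N}}$); a theory is enumerable if its signature and its set of axioms are enumerable. A $\Sigma$-diagram is a $\Sigma$-structure together with a congruence interpreting $=$ (formulas interpreted as usual, reading $=$ as this congruence); a $\mathbb{T}$-model diagram is one satisfying all axioms of $\mathbb{T}$. A diagram (over an enumerable signature) is enumerable if its domain and the interpretations of $=$ and of all relation symbols are enumerable. Fan Theorem (FAN$_D$): for a fan (finitely branching spread), every decidable bar is uniform (there is $n$ such that every path meets the bar within its first $n$ nodes). -}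

module Defs where

open import Data.Nat using (ℕ; zero; suc; _<_; _≤_)
open import Data.Fin using (Fin; zero; suc)
open import Data.Bool using (Bool; true; false)
open import Data.List as List using (List; []; _∷_; _++_; [_])
open import Data.List.Membership.Propositional using (_∈_)
open import Data.Vec as Vec using (Vec)
open import Data.Vec.Relation.Binary.Pointwise.Inductive using (Pointwise)
open import Data.Product using (Σ; ∃; _×_; _,_; proj₁; proj₂)
open import Data.Sum using (_⊎_)
open import Data.Unit using (⊤)
open import Relation.Binary.PropositionalEquality using (_≡_)
open import Relation.Binary.Structures using (IsEquivalence)

SemiDec : (ℕ → ℕ → Bool) → ℕ → Set
SemiDec f a = Σ ℕ λ n → f a n ≡ true

-- The subset {x ∈ X | P x} is enumerable: it is in bijection with a
-- semi-decidable subset of the countable set ℕ.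
record EnumerableSubset {X : Set} (P : X → Set) : Set where
  field
    f      : ℕ → ℕ → Bool
    g      : (a : ℕ) → SemiDec f a → X
    g-irr  : ∀ a (p q : SemiDec f a) → g a p ≡ g a q
    g-into : ∀ a (p : SemiDec f a) → P (g a p)
    g-onto : ∀ x → P x → Σ ℕ λ a → Σ (SemiDec f a) λ p → g a p ≡ x
    g-inj  : ∀ a b (p : SemiDec f a) (q : SemiDec f b) → g a p ≡ g b q → a ≡ b

Enumerable : Set → Set
Enumerable X = EnumerableSubset {X} (λ _ → ⊤)

-- Relation symbols other than equality; equality is built into the syntax.
record Signature : Set₁ where
  field
    Rel   : Set
    arity : Rel → ℕ
open Signature public

module _ (Sg : Signature) where

  data PC (n : ℕ) : Set where
    rel  : (R : Rel Sg) → Vec (Fin n) (arity Sg R) → PC n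
    _≐_  : Fin n → Fin n → PC n
    ⊤ᶜ   : PC n
    _∧ᶜ_ : PC n → PC n → PC n
    _∨ᶜ_ : PC n → PC n → PC n
    ∃ᶜ   : PC (suc n) → PC n

  -- positive coherent sequents  φ ⊢_x ψ  with context x of length m
  PCSeq : Set
  PCSeq = Σ ℕ λ m → PC m × PC m

  -- full first-order formulas (for deduction in intuitionistic free logic)
  data Fm (n : ℕ) : Set where
    rel  : (R : Rel Sg) → Vec (Fin n) (arity Sg R) → Fm n
    _≐_  : Fin n → Fin n → Fm n
    ⊤ᶠ ⊥ᶠ : Fm n
    _∧ᶠ_ _∨ᶠ_ _⇒_ : Fm n → Fm n → Fm n
    ∀ᶠ ∃ᶠ : Fm (suc n) → Fm n

record Theory : Set₁ where
  field
    sig    : Signature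
    Axiom  : PCSeq sig → Set
open Theory public

EnumerableTheory : Theory → Set
EnumerableTheory T =
  Enumerable (Rel (sig T)) × EnumerableSubset {PCSeq (sig T)} (Axiom T)

module _ {Sg : Signature} where

  ⌜_⌝ : ∀ {n} → PC Sg n → Fm Sg n
  ⌜ rel R ts ⌝ = rel R ts
  ⌜ i ≐ j ⌝    = i ≐ j
  ⌜ ⊤ᶜ ⌝       = ⊤ᶠ
  ⌜ φ ∧ᶜ ψ ⌝   = ⌜ φ ⌝ ∧ᶠ ⌜ ψ ⌝
  ⌜ φ ∨ᶜ ψ ⌝   = ⌜ φ ⌝ ∨ᶠ ⌜ ψ ⌝
  ⌜ ∃ᶜ φ ⌝     = ∃ᶠ ⌜ φ ⌝

  ext : ∀ {m n} → (Fin m → Fin n) → Fin (suc m) → Fin (suc n)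
  ext ρ zero    = zero
  ext ρ (suc i) = suc (ρ i)

  ren : ∀ {m n} → (Fin m → Fin n) → Fm Sg m → Fm Sg n
  ren ρ (rel R ts) = rel R (Vec.map ρ ts)
  ren ρ (i ≐ j)    = ρ i ≐ ρ j
  ren ρ ⊤ᶠ         = ⊤ᶠ
  ren ρ ⊥ᶠ         = ⊥ᶠ
  ren ρ (φ ∧ᶠ ψ)   = ren ρ φ ∧ᶠ ren ρ ψ
  ren ρ (φ ∨ᶠ ψ)   = ren ρ φ ∨ᶠ ren ρ ψ
  ren ρ (φ ⇒ ψ)    = ren ρ φ ⇒ ren ρ ψ
  ren ρ (∀ᶠ φ)     = ∀ᶠ (ren (ext ρ) φ)
  ren ρ (∃ᶠ φ)     = ∃ᶠ (ren (ext ρ) φ)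

  wk : ∀ {n} → Fm Sg n → Fm Sg (suc n)
  wk = ren suc

  sub1 : ∀ {n} → Fin n → Fin (suc n) → Fin n
  sub1 t zero    = t
  sub1 t (suc i) = i

  _[_/0] : ∀ {n} → Fm Sg (suc n) → Fin n → Fm Sg n
  φ [ t /0] = ren (sub1 t) φ

  -- existence predicate of free logic: E(t) :≡ t = t
  E : ∀ {n} → Fin n → Fm Sg n
  E t = t ≐ t

  ∀* : (m : ℕ) → Fm Sg m → Fm Sg 0
  ∀* zero    φ = φ
  ∀* (suc m) φ = ∀* m (∀ᶠ φ)

  from0 : ∀ {n} → Fin 0 → Fin n
  from0 ()

  seqFm : PCSeq Sg → Fm Sg 0
  seqFm (m , φ , ψ) = ∀* m (⌜ φ ⌝ ⇒ ⌜ ψ ⌝)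

  -- Natural deduction for intuitionistic free logic with equality
  -- (E-logic, cf. Troelstra–van Dalen), over the axioms Ax.
  data Deriv (Ax : PCSeq Sg → Set) {n : ℕ} (Γ : List (Fm Sg n)) : Fm Sg n → Set where
    ax   : ∀ {s} → Ax s → Deriv Ax Γ (ren from0 (seqFm s))
    hyp  : ∀ {φ} → φ ∈ Γ → Deriv Ax Γ φ
    ⊤I   : Deriv Ax Γ ⊤ᶠ
    ⊥E   : ∀ {φ} → Deriv Ax Γ ⊥ᶠ → Deriv Ax Γ φ
    ∧I   : ∀ {φ ψ} → Deriv Ax Γ φ → Deriv Ax Γ ψ → Deriv Ax Γ (φ ∧ᶠ ψ)
    ∧E₁  : ∀ {φ ψ} → Deriv Ax Γ (φ ∧ᶠ ψ) → Deriv Ax Γ φ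
    ∧E₂  : ∀ {φ ψ} → Deriv Ax Γ (φ ∧ᶠ ψ) → Deriv Ax Γ ψ
    ∨I₁  : ∀ {φ ψ} → Deriv Ax Γ φ → Deriv Ax Γ (φ ∨ᶠ ψ)
    ∨I₂  : ∀ {φ ψ} → Deriv Ax Γ ψ → Deriv Ax Γ (φ ∨ᶠ ψ)
    ∨E   : ∀ {φ ψ χ} → Deriv Ax Γ (φ ∨ᶠ ψ) → Deriv Ax (φ ∷ Γ) χ →
           Deriv Ax (ψ ∷ Γ) χ → Deriv Ax Γ χ
    ⇒I   : ∀ {φ ψ} → Deriv Ax (φ ∷ Γ) ψ → Deriv Ax Γ (φ ⇒ ψ)
    ⇒E   : ∀ {φ ψ} → Deriv Ax Γ (φ ⇒ ψ) → Deriv Ax Γ φ → Deriv Ax Γ ψ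
    ∀I   : ∀ {φ} → Deriv Ax (E zero ∷ List.map wk Γ) φ → Deriv Ax Γ (∀ᶠ φ)
    ∀E   : ∀ {φ} t → Deriv Ax Γ (∀ᶠ φ) → Deriv Ax Γ (E t) → Deriv Ax Γ (φ [ t /0])
    ∃I   : ∀ {φ} t → Deriv Ax Γ (φ [ t /0]) → Deriv Ax Γ (E t) → Deriv Ax Γ (∃ᶠ φ)
    ∃E   : ∀ {φ ψ} → Deriv Ax Γ (∃ᶠ φ) →
           Deriv Ax (φ ∷ E zero ∷ List.map wk Γ) (wk ψ) → Deriv Ax Γ ψ
    ≐sym : ∀ {s t} → Deriv Ax Γ (s ≐ t) → Deriv Ax Γ (t ≐ s)
    ≐sub : ∀ {s t} (φ : Fm Sg (suc n)) → Deriv Ax Γ (s ≐ t) →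
           Deriv Ax Γ (φ [ s /0]) → Deriv Ax Γ (φ [ t /0])
    strict-≐   : ∀ {s t} → Deriv Ax Γ (s ≐ t) → Deriv Ax Γ (E s)
    strict-rel : ∀ {R ts} → Deriv Ax Γ (rel R ts) → (i : Fin (arity Sg R)) →
                 Deriv Ax Γ (E (Vec.lookup ts i))

Provable : (T : Theory) → PCSeq (sig T) → Set
Provable T s = Deriv (Axiom T) [] (seqFm s)

record Diagram (Sg : Signature) : Set₁ where
  field
    D       : Set
    _~_     : D → D → Set
    ~-equiv : IsEquivalence _~_
    ⟦_⟧ᴿ    : (R : Rel Sg) → Vec D (arity Sg R) → Set
    ⟦⟧ᴿ-cong : ∀ R {xs ys} → Pointwise _~_ xs ys → ⟦ R ⟧ᴿ xs → ⟦ R ⟧ᴿ ys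
open Diagram public

module _ {Sg : Signature} (M : Diagram Sg) where

  extend : ∀ {n} → D M → (Fin n → D M) → Fin (suc n) → D M
  extend d ρ zero    = d
  extend d ρ (suc i) = ρ i

  ⟦_⟧ : ∀ {n} → PC Sg n → (Fin n → D M) → Set
  ⟦ rel R ts ⟧ ρ = ⟦_⟧ᴿ M R (Vec.map ρ ts)
  ⟦ i ≐ j ⟧    ρ = _~_ M (ρ i) (ρ j)
  ⟦ ⊤ᶜ ⟧       ρ = ⊤
  ⟦ φ ∧ᶜ ψ ⟧   ρ = ⟦ φ ⟧ ρ × ⟦ ψ ⟧ ρ
  ⟦ φ ∨ᶜ ψ ⟧   ρ = ⟦ φ ⟧ ρ ⊎ ⟦ ψ ⟧ ρ
  ⟦ ∃ᶜ φ ⟧     ρ = Σ (D M) λ d → ⟦ φ ⟧ (extend d ρ)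

  _⊨_ : PCSeq Sg → Set
  _⊨_ (m , φ , ψ) = (ρ : Fin m → D M) → ⟦ φ ⟧ ρ → ⟦ ψ ⟧ ρ

IsModel : (T : Theory) → Diagram (sig T) → Set
IsModel T M = ∀ s → Axiom T s → M ⊨ s

EnumerableDiagram : {Sg : Signature} → Diagram Sg → Set
EnumerableDiagram {Sg} M =
  Enumerable (D M) ×
  EnumerableSubset {D M × D M} (λ p → _~_ M (proj₁ p) (proj₂ p)) ×
  ((R : Rel Sg) → EnumerableSubset {Vec (D M) (arity Sg R)} (⟦_⟧ᴿ M R))

initSeg : (ℕ → ℕ) → ℕ → List ℕ
initSeg α n = List.map α (List.upTo n)

record Spread : Set where
  field
    node        : List ℕ → Bool
    root        : node [] ≡ true
    prefix-cl   : ∀ s k → node (s ++ [ k ]) ≡ true → node s ≡ true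
    has-succ    : ∀ s → node s ≡ true → Σ ℕ λ k → node (s ++ [ k ]) ≡ true
open Spread public

record Fan : Set where
  field
    spread   : Spread
    fin-branch : ∀ s → node spread s ≡ true →
                 Σ ℕ λ b → ∀ k → node spread (s ++ [ k ]) ≡ true → k < b
open Fan public

IsPath : Spread → (ℕ → ℕ) → Set
IsPath S α = ∀ n → node S (initSeg α n) ≡ true

IsBar : Fan → (List ℕ → Bool) → Set
IsBar F B = ∀ α → IsPath (spread F) α → Σ ℕ λ n → B (initSeg α n) ≡ true

IsUniformBar : Fan → (List ℕ → Bool) → Set
IsUniformBar F B = Σ ℕ λ N → ∀ α → IsPath (spread F) α →
                   Σ ℕ λ n → n ≤ N × B (initSeg α n) ≡ true

FAN-D : Set
FAN-D = (F : Fan) (B : List ℕ → Bool) → IsBar F B → IsUniformBar F B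

-- We run a fair proof search whose states are finite lists
-- of ground facts over finitely many names together with pending positive
-- formulas.  Step j performs the task coded by j: fire an instance of an
-- axiom, decompose a pending formula, or close the facts under symmetry,
-- transitivity and congruence of equality.  An existential introduces a
-- fresh name; a disjunction branches, the branch being read off a binary
-- sequence α.  The runs of the search therefore form a binary fan.
--
--  * Backward soundness: if both successors of a state derive ψ at the
--    generic names, so does the state itself; at the root this is a
--    derivation of the sequent.
--  * Along every path α the facts ever recorded form an enumerable T-model
--    diagram satisfying φ at the generic names, hence ψ by hypothesis, so
--    ψ is eventually recorded: "ψ has been recorded" is a decidable bar.
--  * FAN-D makes this bar uniform, and backward induction from the uniform
--    depth, using backward soundness, yields the derivation.
module Submission where

open import Defs

open import Axiom.UniquenessOfIdentityProofs using (module Decidable⇒UIP)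
import Data.Bool as Bool
open import Data.Bool using (Bool; true; false; _∧_; _∨_; if_then_else_)
open import Data.Bool.Properties using (∧-conicalˡ; ∧-conicalʳ)
open import Data.Bool.ListAction using (any; all)
open import Data.Empty using (⊥-elim)
open import Data.Fin as F using (Fin; zero; suc; toℕ)
open import Data.List as L using (List; []; _∷_; _++_; [_])
import Data.List.Properties as LP
open import Data.List.Membership.Propositional using (_∈_)
open import Data.List.Membership.Propositional.Properties
  using (∈-map⁺; ∈-map⁻; ∈-++⁺ʳ; ∈-++⁻; ∈-tabulate⁺; ∈-tabulate⁻)
open import Data.List.Relation.Unary.Any using (here; there)
open import Data.Maybe using (Maybe; just; nothing; maybe)
import Data.Maybe as Maybe
open import Data.Nat as N using (ℕ; zero; suc; _+_; _∸_; _≤_; _<_)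
import Data.Nat.Properties as NP
open import Data.Product using (Σ; _×_; _,_; proj₁; proj₂)
open import Data.Sum using (_⊎_; inj₁; inj₂)
open import Data.Unit using (tt)
open import Data.Vec as V using (Vec; []; _∷_; _[_]≔_)
import Data.Vec.Properties as VP
open import Data.Vec.Relation.Binary.Pointwise.Inductive using (Pointwise; []; _∷_)
open import Function using (_∘_; id)
open import Relation.Binary.PropositionalEquality hiding ([_])
open import Relation.Binary.Structures using (IsEquivalence)
open import Relation.Nullary using (Dec; yes; no; ¬_)
open import Relation.Nullary.Decidable using (map′; ⌊_⌋)

∧-true⁻ : ∀ {a b} → a ∧ b ≡ true → a ≡ true × b ≡ true
∧-true⁻ {a} {b} e = ∧-conicalˡ a b e , ∧-conicalʳ a b e

∨-true⁻ : ∀ {a b} → a ∨ b ≡ true → a ≡ true ⊎ b ≡ true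
∨-true⁻ {true}  e = inj₁ refl
∨-true⁻ {false} e = inj₂ e

∨-trueˡ : ∀ {a b} → a ≡ true → a ∨ b ≡ true
∨-trueˡ refl = refl

∨-trueʳ : ∀ {a b} → b ≡ true → a ∨ b ≡ true
∨-trueʳ {true}  e = refl
∨-trueʳ {false} e = e

-- Proofs of Boolean equations are unique; needed to identify elements of
-- subsets cut out by Boolean tests.
bool-uip : ∀ {b c : Bool} (p q : b ≡ c) → p ≡ q
bool-uip = Decidable⇒UIP.≡-irrelevant Bool._≟_

_<?ᵇ_ : ℕ → ℕ → Bool
c <?ᵇ m = ⌊ c N.<? m ⌋

<?ᵇ-sound : ∀ c m → c <?ᵇ m ≡ true → c < m
<?ᵇ-sound c m e with c N.<? m
... | yes p = p

<?ᵇ-complete : ∀ {c m} → c < m → c <?ᵇ m ≡ true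
<?ᵇ-complete {c} {m} p with c N.<? m
... | yes _ = refl
... | no ¬p = ⊥-elim (¬p p)

<?ᵇ-refute : ∀ {c m} → ¬ c < m → c <?ᵇ m ≡ false
<?ᵇ-refute {c} {m} ¬p with c N.<? m
... | yes p = ⊥-elim (¬p p)
... | no _  = refl

-- Partial lookup in a list by a natural-number position: the search
-- refers to items by their (stable) position in the state.
_‼_ : ∀ {A : Set} → List A → ℕ → Maybe A
[]      ‼ _     = nothing
(x ∷ l) ‼ zero  = just x
(x ∷ l) ‼ suc p = l ‼ p

‼-∈ : ∀ {A : Set} (l : List A) p {x} → l ‼ p ≡ just x → x ∈ l
‼-∈ (y ∷ l) zero    refl = here refl
‼-∈ (y ∷ l) (suc p) e    = there (‼-∈ l p e)

∈-‼ : ∀ {A : Set} {x : A} {l} → x ∈ l → Σ ℕ λ p → l ‼ p ≡ just x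
∈-‼ (here refl) = zero , refl
∈-‼ (there q) with ∈-‼ q
... | p , e = suc p , e

‼-++ : ∀ {A : Set} (xs ys : List A) p {x} → xs ‼ p ≡ just x → (xs ++ ys) ‼ p ≡ just x
‼-++ (y ∷ xs) ys zero    e = e
‼-++ (y ∷ xs) ys (suc p) e = ‼-++ xs ys p e

‼-++-length : ∀ {A : Set} (xs ys : List A) i → (xs ++ ys) ‼ (L.length xs + i) ≡ ys ‼ i
‼-++-length []       ys i = refl
‼-++-length (x ∷ xs) ys i = ‼-++-length xs ys i

‼-map : ∀ {A B : Set} (f : A → B) (xs : List A) p {x} → xs ‼ p ≡ just x → L.map f xs ‼ p ≡ just (f x)
‼-map f (y ∷ xs) zero    refl = refl
‼-map f (y ∷ xs) (suc p) e    = ‼-map f xs p e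

pointwise-by-updates : ∀ {A : Set} {_∼_ : A → A → Set} {k} (Q : Vec A k → Set) →
                       (∀ zs r y → V.lookup zs r ∼ y → Q zs → Q (zs [ r ]≔ y)) →
                       ∀ {xs ys} → Pointwise _∼_ xs ys → Q xs → Q ys
pointwise-by-updates Q upd [] q = q
pointwise-by-updates Q upd {x ∷ xs} {y ∷ ys} (e ∷ es) q =
  pointwise-by-updates (λ w → Q (y ∷ w)) (λ zs r z e′ q′ → upd (y ∷ zs) (suc r) z e′ q′) es (upd (x ∷ xs) zero y e q)

toFin : (a : ℕ) → ℕ → Maybe (Fin a)
toFin zero    _       = nothing
toFin (suc a) zero    = just zero
toFin (suc a) (suc r) = Maybe.map suc (toFin a r)

toFin-toℕ : ∀ {a} (r : Fin a) → toFin a (toℕ r) ≡ just r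
toFin-toℕ zero = refl
toFin-toℕ (suc r) rewrite toFin-toℕ r = refl

-- The de Bruijn level of a variable i : Fin K (counting from the
-- outermost).  Weakening by `suc` preserves levels, so levels serve as
-- global names of the variables introduced during the search.
level : ∀ {K} → Fin K → ℕ
level {suc K} zero    = K
level {suc K} (suc i) = level i

level< : ∀ {K} (i : Fin K) → level i < K
level< {suc K} zero    = NP.≤-refl
level< {suc K} (suc i) = NP.m<n⇒m<1+n (level< i)

level-injective : ∀ {K} {i j : Fin K} → level i ≡ level j → i ≡ j
level-injective {suc K} {zero}  {zero}  e = refl
level-injective {suc K} {zero}  {suc j} e = ⊥-elim (NP.<-irrefl (sym e) (level< j))
level-injective {suc K} {suc i} {zero}  e = ⊥-elim (NP.<-irrefl e (level< i))
level-injective {suc K} {suc i} {suc j} e = cong suc (level-injective e)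

levels-injective : ∀ {K k} {xs ys : Vec (Fin K) k} → V.map level xs ≡ V.map level ys → xs ≡ ys
levels-injective {xs = []}     {[]}     e = refl
levels-injective {xs = x ∷ xs} {y ∷ ys} e =
  cong₂ _∷_ (level-injective (VP.∷-injectiveˡ e)) (levels-injective (VP.∷-injectiveʳ e))

level-surjective : ∀ K c → c < K → Σ (Fin K) λ i → level i ≡ c
level-surjective (suc K) c lt with c NP.≟ K
... | yes e = zero , sym e
... | no ne with level-surjective K c (NP.≤∧≢⇒< (N.s≤s⁻¹ lt) ne)
...   | i , e = suc i , e

levels-wk : ∀ {K n} (xs : Vec (Fin K) n) → V.map level (V.map suc xs) ≡ V.map level xs
levels-wk xs = sym (VP.map-∘ level suc xs)

-- The Cantor pairing ⟪ a , b ⟫ = triangle (a + b) + b, inverted by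
-- enumerating the pairs diagonal by diagonal.  Besides bijectivity, the
-- search uses `≤-pair`: a task coded by t is performed at the stages
-- ⟪ t , n ⟫ ≥ n, hence arbitrarily late.

triangle : ℕ → ℕ
triangle zero    = zero
triangle (suc s) = triangle s + suc s

⟪_,_⟫ : ℕ → ℕ → ℕ
⟪ a , b ⟫ = triangle (a + b) + b

nextPair : ℕ × ℕ → ℕ × ℕ
nextPair (zero  , b) = (suc b , zero)
nextPair (suc a , b) = (a , suc b)

unpair : ℕ → ℕ × ℕ
unpair zero    = (zero , zero)
unpair (suc n) = nextPair (unpair n)

pairᵘ : ℕ × ℕ → ℕ
pairᵘ (a , b) = ⟪ a , b ⟫

pair-nextPair : ∀ p → pairᵘ (nextPair p) ≡ suc (pairᵘ p)
pair-nextPair (zero , b) = begin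
    triangle (suc b + 0) + 0  ≡⟨ NP.+-identityʳ _ ⟩
    triangle (suc b + 0)      ≡⟨ cong triangle (NP.+-identityʳ (suc b)) ⟩
    triangle b + suc b        ≡⟨ NP.+-suc (triangle b) b ⟩
    suc (triangle b + b)      ∎
  where open ≡-Reasoning
pair-nextPair (suc a , b) = begin
    triangle (a + suc b) + suc b  ≡⟨ cong (λ x → triangle x + suc b) (NP.+-suc a b) ⟩
    triangle (suc a + b) + suc b  ≡⟨ NP.+-suc _ b ⟩
    suc (triangle (suc a + b) + b) ∎
  where open ≡-Reasoning

pair-unpair : ∀ n → pairᵘ (unpair n) ≡ n
pair-unpair zero    = refl
pair-unpair (suc n) = trans (pair-nextPair (unpair n)) (cong suc (pair-unpair n))

unpair-diagonal : ∀ s a b → a + b ≡ s → unpair (triangle s + b) ≡ (a , b)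
unpair-diagonal zero zero zero e = refl
unpair-diagonal (suc s) a zero e = begin
    unpair (triangle (suc s) + 0)   ≡⟨ cong unpair (NP.+-identityʳ (triangle (suc s))) ⟩
    unpair (triangle s + suc s)     ≡⟨ cong unpair (NP.+-suc (triangle s) s) ⟩
    nextPair (unpair (triangle s + s)) ≡⟨ cong nextPair (unpair-diagonal s zero s refl) ⟩
    (suc s , 0)                     ≡⟨ cong (_, 0) (sym (trans (sym (NP.+-identityʳ a)) e)) ⟩
    (a , 0)                         ∎
  where open ≡-Reasoning
unpair-diagonal (suc s) a (suc b) e = begin
    unpair (triangle (suc s) + suc b)   ≡⟨ cong unpair (NP.+-suc (triangle (suc s)) b) ⟩
    nextPair (unpair (triangle (suc s) + b))
      ≡⟨ cong nextPair (unpair-diagonal (suc s) (suc a) b (trans (sym (NP.+-suc a b)) e)) ⟩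
    (a , suc b)                          ∎
  where open ≡-Reasoning

unpair-pair : ∀ a b → unpair ⟪ a , b ⟫ ≡ (a , b)
unpair-pair a b = unpair-diagonal (a + b) a b refl

≤-pair : ∀ a b → b ≤ ⟪ a , b ⟫
≤-pair a b = NP.m≤n+m b (triangle (a + b))

decodeVec : (k : ℕ) → ℕ → Vec ℕ k
decodeVec zero    n = []
decodeVec (suc k) n = proj₁ (unpair n) ∷ decodeVec k (proj₂ (unpair n))

encodeVec : ∀ {k} → Vec ℕ k → ℕ
encodeVec []      = 0
encodeVec (x ∷ v) = ⟪ x , encodeVec v ⟫

decodeVec-encodeVec : ∀ {k} (v : Vec ℕ k) → decodeVec k (encodeVec v) ≡ v
decodeVec-encodeVec []      = refl
decodeVec-encodeVec (x ∷ v) rewrite unpair-pair x (encodeVec v) = cong (x ∷_) (decodeVec-encodeVec v)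

record Coding (X : Set) : Set where
  field
    code        : X → ℕ
    decode      : ℕ → Maybe X
    decode-code : ∀ x → decode (code x) ≡ just x
    code-decode : ∀ a {x} → decode a ≡ just x → code x ≡ a

-- A subset of a coded set with a semi-decidable membership test is
-- enumerable: enumerate the codes that decode to an element passing the
-- test at some time n.
coded-enumerable : ∀ {X : Set} (C : Coding X) {P : X → Set} (test : X → ℕ → Bool) →
                   (∀ x n → test x n ≡ true → P x) → (∀ x → P x → Σ ℕ λ n → test x n ≡ true) →
                   EnumerableSubset P
coded-enumerable {X} C {P} test sound complete = record
  { f      = λ a n → passes (decode a) n
  ; g      = λ a → element (decode a)
  ; g-irr  = λ a → element-irr (decode a)
  ; g-into = λ a → element-into (decode a)
  ; g-onto = onto
  ; g-inj  = λ a b p q e → trans (sym (element-code a (decode a) refl p))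
                                 (trans (cong code e) (element-code b (decode b) refl q))
  }
  where
    open Coding C

    passes : Maybe X → ℕ → Bool
    passes (just x) n = test x n
    passes nothing  n = false

    element : (mx : Maybe X) → Σ ℕ (λ n → passes mx n ≡ true) → X
    element (just x) _ = x

    element-irr : ∀ mx p q → element mx p ≡ element mx q
    element-irr (just x) p q = refl

    element-into : ∀ mx p → P (element mx p)
    element-into (just x) (n , e) = sound x n e

    element-code : ∀ a mx → decode a ≡ mx → ∀ p → code (element mx p) ≡ a
    element-code a (just x) e p = code-decode a e

    onto : ∀ x → P x → Σ ℕ λ a → Σ (Σ ℕ λ n → passes (decode a) n ≡ true) λ p → element (decode a) p ≡ x
    onto x px = code x , subst (λ mx → Σ (Σ ℕ λ n → passes mx n ≡ true) λ p → element mx p ≡ x)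
                               (sym (decode-code x)) (complete x px , refl)

both : ∀ {A B : Set} → Maybe A → Maybe B → Maybe (A × B)
both (just x) (just y) = just (x , y)
both _        _        = nothing

both-just : ∀ {A B : Set} (ma : Maybe A) (mb : Maybe B) {x y} → both ma mb ≡ just (x , y) → ma ≡ just x × mb ≡ just y
both-just (just x) (just y) refl = refl , refl

pairCoding : ∀ {A B : Set} → Coding A → Coding B → Coding (A × B)
pairCoding {A} {B} CA CB = record
  { code        = λ { (x , y) → ⟪ CA.code x , CB.code y ⟫ }
  ; decode      = decode
  ; decode-code = λ { (x , y) → decode-code x y }
  ; code-decode = code-decode
  }
  where
    module CA = Coding CA
    module CB = Coding CB

    decode : ℕ → Maybe (A × B)
    decode n = both (CA.decode (proj₁ (unpair n))) (CB.decode (proj₂ (unpair n)))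

    decode-code : ∀ x y → decode ⟪ CA.code x , CB.code y ⟫ ≡ just (x , y)
    decode-code x y rewrite unpair-pair (CA.code x) (CB.code y) | CA.decode-code x | CB.decode-code y = refl

    code-decode : ∀ n {xy} → decode n ≡ just xy → ⟪ CA.code (proj₁ xy) , CB.code (proj₂ xy) ⟫ ≡ n
    code-decode n {x , y} e with both-just (CA.decode (proj₁ (unpair n))) (CB.decode (proj₂ (unpair n))) e
    ... | e₁ , e₂ = trans (cong₂ ⟪_,_⟫ (CA.code-decode _ e₁) (CB.code-decode _ e₂)) (pair-unpair n)

vecCoding : ∀ {A : Set} → Coding A → ∀ k → Coding (Vec A k)
vecCoding {A} C zero = record
  { code        = λ _ → 0
  ; decode      = λ { zero → just [] ; (suc _) → nothing }
  ; decode-code = λ { [] → refl }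
  ; code-decode = λ { zero refl → refl }
  }
vecCoding {A} C (suc k) = record
  { code        = λ v → P.code (V.head v , V.tail v)
  ; decode      = λ n → Maybe.map (λ { (x , xs) → x ∷ xs }) (P.decode n)
  ; decode-code = λ { (x ∷ xs) → cong (Maybe.map _) (P.decode-code (x , xs)) }
  ; code-decode = code-decode
  }
  where
    module P = Coding (pairCoding C (vecCoding C k))

    code-decode : ∀ n {v} → Maybe.map (λ { (x , xs) → x ∷ xs }) (P.decode n) ≡ just v →
                  P.code (V.head v , V.tail v) ≡ n
    code-decode n e with P.decode n in eₙ
    code-decode n refl | just (x , xs) = P.code-decode n eₙ

module Syntax {Sg : Signature} where

  -- `ext`, `sub1` and `from0` do not mention the signature in their types,
  -- so we fix it once here.
  lift : ∀ {m n} → (Fin m → Fin n) → Fin (suc m) → Fin (suc n)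
  lift = ext {Sg}

  sub₀ : ∀ {n} → Fin n → Fin (suc n) → Fin n
  sub₀ = sub1 {Sg}

  noVar : ∀ {n} → Fin 0 → Fin n
  noVar = from0 {Sg}

  lift-cong : ∀ {m n} {ρ σ : Fin m → Fin n} → (∀ i → ρ i ≡ σ i) → ∀ i → lift ρ i ≡ lift σ i
  lift-cong e zero    = refl
  lift-cong e (suc i) = cong suc (e i)

  ren-cong : ∀ {m n} {ρ σ : Fin m → Fin n} → (∀ i → ρ i ≡ σ i) → (φ : Fm Sg m) → ren ρ φ ≡ ren σ φ
  ren-cong e (rel R ts) = cong (rel R) (VP.map-cong e ts)
  ren-cong e (i ≐ j)    = cong₂ _≐_ (e i) (e j)
  ren-cong e ⊤ᶠ         = refl
  ren-cong e ⊥ᶠ         = refl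
  ren-cong e (φ ∧ᶠ ψ)   = cong₂ _∧ᶠ_ (ren-cong e φ) (ren-cong e ψ)
  ren-cong e (φ ∨ᶠ ψ)   = cong₂ _∨ᶠ_ (ren-cong e φ) (ren-cong e ψ)
  ren-cong e (φ ⇒ ψ)    = cong₂ _⇒_ (ren-cong e φ) (ren-cong e ψ)
  ren-cong e (∀ᶠ φ)     = cong ∀ᶠ (ren-cong (lift-cong e) φ)
  ren-cong e (∃ᶠ φ)     = cong ∃ᶠ (ren-cong (lift-cong e) φ)

  lift-∘ : ∀ {l m n} (σ : Fin m → Fin n) (ρ : Fin l → Fin m) → ∀ i → lift σ (lift ρ i) ≡ lift (σ ∘ ρ) i
  lift-∘ σ ρ zero    = refl
  lift-∘ σ ρ (suc i) = refl

  ren-∘ : ∀ {l m n} (σ : Fin m → Fin n) (ρ : Fin l → Fin m) (φ : Fm Sg l) → ren σ (ren ρ φ) ≡ ren (σ ∘ ρ) φ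
  ren-∘ σ ρ (rel R ts) = cong (rel R) (sym (VP.map-∘ σ ρ ts))
  ren-∘ σ ρ (i ≐ j)    = refl
  ren-∘ σ ρ ⊤ᶠ         = refl
  ren-∘ σ ρ ⊥ᶠ         = refl
  ren-∘ σ ρ (φ ∧ᶠ ψ)   = cong₂ _∧ᶠ_ (ren-∘ σ ρ φ) (ren-∘ σ ρ ψ)
  ren-∘ σ ρ (φ ∨ᶠ ψ)   = cong₂ _∨ᶠ_ (ren-∘ σ ρ φ) (ren-∘ σ ρ ψ)
  ren-∘ σ ρ (φ ⇒ ψ)    = cong₂ _⇒_ (ren-∘ σ ρ φ) (ren-∘ σ ρ ψ)
  ren-∘ σ ρ (∀ᶠ φ)     = cong ∀ᶠ (trans (ren-∘ (lift σ) (lift ρ) φ) (ren-cong (lift-∘ σ ρ) φ))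
  ren-∘ σ ρ (∃ᶠ φ)     = cong ∃ᶠ (trans (ren-∘ (lift σ) (lift ρ) φ) (ren-cong (lift-∘ σ ρ) φ))

  lift-id : ∀ {n} (i : Fin (suc n)) → lift id i ≡ i
  lift-id zero    = refl
  lift-id (suc i) = refl

  ren-id : ∀ {n} (φ : Fm Sg n) → ren id φ ≡ φ
  ren-id (rel R ts) = cong (rel R) (VP.map-id ts)
  ren-id (i ≐ j)    = refl
  ren-id ⊤ᶠ         = refl
  ren-id ⊥ᶠ         = refl
  ren-id (φ ∧ᶠ ψ)   = cong₂ _∧ᶠ_ (ren-id φ) (ren-id ψ)
  ren-id (φ ∨ᶠ ψ)   = cong₂ _∨ᶠ_ (ren-id φ) (ren-id ψ)
  ren-id (φ ⇒ ψ)    = cong₂ _⇒_ (ren-id φ) (ren-id ψ)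
  ren-id (∀ᶠ φ)     = cong ∀ᶠ (trans (ren-cong lift-id φ) (ren-id φ))
  ren-id (∃ᶠ φ)     = cong ∃ᶠ (trans (ren-cong lift-id φ) (ren-id φ))

  ren-wk : ∀ {m n} (ρ : Fin m → Fin n) (φ : Fm Sg m) → ren (lift ρ) (wk φ) ≡ wk (ren ρ φ)
  ren-wk ρ φ = trans (ren-∘ (lift ρ) suc φ) (sym (ren-∘ suc ρ φ))

  ren-sub : ∀ {m n} (ρ : Fin m → Fin n) (t : Fin m) (φ : Fm Sg (suc m)) →
            ren ρ (φ [ t /0]) ≡ ren (lift ρ) φ [ ρ t /0]
  ren-sub ρ t φ = trans (ren-∘ ρ (sub₀ t) φ) (trans (ren-cong commute φ) (sym (ren-∘ (sub₀ (ρ t)) (lift ρ) φ)))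
    where commute : ∀ i → ρ (sub₀ t i) ≡ sub₀ (ρ t) (lift ρ i)
          commute zero    = refl
          commute (suc i) = refl

  sub-lift : ∀ {K k} (i : Fin K) (w : Vec (Fin K) k) (X : Fm Sg (suc k)) →
             ren (lift (V.lookup w)) X [ i /0] ≡ ren (V.lookup (i ∷ w)) X
  sub-lift i w X = trans (ren-∘ (sub₀ i) (lift (V.lookup w)) X) (ren-cong pointwise X)
    where pointwise : ∀ j → sub₀ i (lift (V.lookup w) j) ≡ V.lookup (i ∷ w) j
          pointwise zero    = refl
          pointwise (suc j) = refl

  ren-closed : ∀ {n n'} (ρ : Fin n → Fin n') (φ : Fm Sg 0) → ren ρ (ren noVar φ) ≡ ren noVar φ
  ren-closed ρ φ = trans (ren-∘ ρ noVar φ) (ren-cong (λ ()) φ)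

  _⊆_ : ∀ {n} → List (Fm Sg n) → List (Fm Sg n) → Set
  Γ ⊆ Δ = ∀ {x} → x ∈ Γ → x ∈ Δ

  ∷-⊆ : ∀ {n} {Γ Δ : List (Fm Sg n)} {φ} → Γ ⊆ Δ → (φ ∷ Γ) ⊆ (φ ∷ Δ)
  ∷-⊆ s (here p)  = here p
  ∷-⊆ s (there p) = there (s p)

  map-⊆ : ∀ {m n} {Γ Δ : List (Fm Sg m)} (f : Fm Sg m → Fm Sg n) → Γ ⊆ Δ → L.map f Γ ⊆ L.map f Δ
  map-⊆ f s p with ∈-map⁻ f p
  ... | x , x∈ , refl = ∈-map⁺ f (s x∈)

  map-wk : ∀ {m n} (ρ : Fin m → Fin n) (Γ : List (Fm Sg m)) →
           L.map (ren (lift ρ)) (L.map wk Γ) ≡ L.map wk (L.map (ren ρ) Γ)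
  map-wk ρ []      = refl
  map-wk ρ (x ∷ Γ) = cong₂ _∷_ (ren-wk ρ x) (map-wk ρ Γ)

  existCtx : (n : ℕ) → List (Fm Sg n)
  existCtx zero    = []
  existCtx (suc n) = E zero ∷ L.map wk (existCtx n)

  E∈existCtx : ∀ {n} (i : Fin n) → E i ∈ existCtx n
  E∈existCtx zero    = here refl
  E∈existCtx (suc i) = there (∈-map⁺ wk (E∈existCtx i))

  module _ {Ax : PCSeq Sg → Set} where

    weaken : ∀ {n} {Γ Δ : List (Fm Sg n)} {φ} → Γ ⊆ Δ → Deriv Ax Γ φ → Deriv Ax Δ φ
    weaken s (ax a)           = ax a
    weaken s (hyp p)          = hyp (s p)
    weaken s ⊤I               = ⊤I
    weaken s (⊥E d)           = ⊥E (weaken s d)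
    weaken s (∧I d e)         = ∧I (weaken s d) (weaken s e)
    weaken s (∧E₁ d)          = ∧E₁ (weaken s d)
    weaken s (∧E₂ d)          = ∧E₂ (weaken s d)
    weaken s (∨I₁ d)          = ∨I₁ (weaken s d)
    weaken s (∨I₂ d)          = ∨I₂ (weaken s d)
    weaken s (∨E d e f)       = ∨E (weaken s d) (weaken (∷-⊆ s) e) (weaken (∷-⊆ s) f)
    weaken s (⇒I d)           = ⇒I (weaken (∷-⊆ s) d)
    weaken s (⇒E d e)         = ⇒E (weaken s d) (weaken s e)
    weaken s (∀I d)           = ∀I (weaken (∷-⊆ (map-⊆ wk s)) d)
    weaken s (∀E t d e)       = ∀E t (weaken s d) (weaken s e)
    weaken s (∃I t d e)       = ∃I t (weaken s d) (weaken s e)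
    weaken s (∃E d e)         = ∃E (weaken s d) (weaken (∷-⊆ (∷-⊆ (map-⊆ wk s))) e)
    weaken s (≐sym d)         = ≐sym (weaken s d)
    weaken s (≐sub φ d e)     = ≐sub φ (weaken s d) (weaken s e)
    weaken s (strict-≐ d)     = strict-≐ (weaken s d)
    weaken s (strict-rel d i) = strict-rel (weaken s d) i

    rename : ∀ {m n} (ρ : Fin m → Fin n) {Γ : List (Fm Sg m)} {φ} →
             Deriv Ax Γ φ → Deriv Ax (L.map (ren ρ) Γ) (ren ρ φ)
    rename ρ (ax {s} a)  = subst (Deriv Ax _) (sym (ren-closed ρ (seqFm s))) (ax a)
    rename ρ (hyp p)     = hyp (∈-map⁺ (ren ρ) p)
    rename ρ ⊤I          = ⊤I
    rename ρ (⊥E d)      = ⊥E (rename ρ d)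
    rename ρ (∧I d e)    = ∧I (rename ρ d) (rename ρ e)
    rename ρ (∧E₁ d)     = ∧E₁ (rename ρ d)
    rename ρ (∧E₂ d)     = ∧E₂ (rename ρ d)
    rename ρ (∨I₁ d)     = ∨I₁ (rename ρ d)
    rename ρ (∨I₂ d)     = ∨I₂ (rename ρ d)
    rename ρ (∨E d e f)  = ∨E (rename ρ d) (rename ρ e) (rename ρ f)
    rename ρ (⇒I d)      = ⇒I (rename ρ d)
    rename ρ (⇒E d e)    = ⇒E (rename ρ d) (rename ρ e)
    rename ρ {Γ} (∀I d)  = ∀I (subst (λ Δ → Deriv Ax (E zero ∷ Δ) _) (map-wk ρ Γ) (rename (lift ρ) d))
    rename ρ (∀E {φ} t d e) =
      subst (Deriv Ax _) (sym (ren-sub ρ t φ)) (∀E (ρ t) (rename ρ d) (rename ρ e))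
    rename ρ (∃I {φ} t d e) = ∃I (ρ t) (subst (Deriv Ax _) (ren-sub ρ t φ) (rename ρ d)) (rename ρ e)
    rename ρ {Γ} (∃E {φ} {ψ} d e) =
      ∃E (rename ρ d)
         (subst₂ (λ Δ χ → Deriv Ax (ren (lift ρ) φ ∷ E zero ∷ Δ) χ) (map-wk ρ Γ) (ren-wk ρ ψ)
                 (rename (lift ρ) e))
    rename ρ (≐sym d)    = ≐sym (rename ρ d)
    rename ρ (≐sub {s} {t} φ d e) =
      subst (Deriv Ax _) (sym (ren-sub ρ t φ))
        (≐sub (ren (lift ρ) φ) (rename ρ d) (subst (Deriv Ax _) (ren-sub ρ s φ) (rename ρ e)))
    rename ρ (strict-≐ d) = strict-≐ (rename ρ d)
    rename ρ (strict-rel {R} {ts} d i) =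
      subst (λ x → Deriv Ax _ (x ≐ x)) (VP.lookup-map i ρ ts) (strict-rel (rename ρ d) i)

    cutAll : ∀ {n} {Γ Δ : List (Fm Sg n)} {g} → Deriv Ax Γ g → (∀ {γ} → γ ∈ Γ → Deriv Ax Δ γ) → Deriv Ax Δ g
    cutAll {Γ = []}    d h = weaken (λ ()) d
    cutAll {Γ = γ ∷ Γ} d h = ⇒E (cutAll (⇒I d) (h ∘ there)) (h (here refl))

    instantiate : ∀ {n} {Γ : List (Fm Sg n)} k (X : Fm Sg k) (σ : Fin k → Fin n) →
                  (∀ i → Deriv Ax Γ (E (σ i))) → Deriv Ax Γ (ren noVar (∀* k X)) → Deriv Ax Γ (ren σ X)
    instantiate zero    X σ es d = subst (Deriv Ax _) (ren-cong (λ ()) X) d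
    instantiate (suc k) X σ es d =
      subst (Deriv Ax _) (trans (ren-∘ (sub₀ (σ zero)) (lift (σ ∘ suc)) X) (ren-cong pointwise X))
        (∀E (σ zero) (instantiate k (∀ᶠ X) (σ ∘ suc) (es ∘ suc) d) (es zero))
      where pointwise : ∀ j → sub₀ (σ zero) (lift (σ ∘ suc) j) ≡ σ j
            pointwise zero    = refl
            pointwise (suc j) = refl

    generalize : ∀ n (X : Fm Sg n) → Deriv Ax (existCtx n) X → Deriv Ax [] (∀* n X)
    generalize zero    X d = d
    generalize (suc n) X d = generalize n (∀ᶠ X) (∀I d)

-- An enumerable set has decidable equality: compare the unique codes.
enumerable-≟ : ∀ {X : Set} → Enumerable X → (x y : X) → Dec (x ≡ y)
enumerable-≟ {X} eX x y = map′ code-injective (cong code) (code x NP.≟ code y)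
  where
    open EnumerableSubset eX
    code : X → ℕ
    code z = proj₁ (g-onto z tt)

    g-cong : ∀ a a' (p : SemiDec f a) (p' : SemiDec f a') → a ≡ a' → g a p ≡ g a' p'
    g-cong a .a p p' refl = g-irr a p p'

    code-injective : ∀ {z z'} → code z ≡ code z' → z ≡ z'
    code-injective {z} {z'} e =
      trans (sym (proj₂ (proj₂ (g-onto z tt))))
        (trans (g-cong _ _ (proj₁ (proj₂ (g-onto z tt))) (proj₁ (proj₂ (g-onto z' tt))) e)
               (proj₂ (proj₂ (g-onto z' tt))))

binary : List ℕ → Bool
binary = all (λ x → x <?ᵇ 2)

binary-prefix : ∀ s k → binary (s ++ [ k ]) ≡ true → binary s ≡ true
binary-prefix []      k e = refl
binary-prefix (x ∷ s) k e =
  cong₂ _∧_ (proj₁ (∧-true⁻ {x <?ᵇ 2} e)) (binary-prefix s k (proj₂ (∧-true⁻ {x <?ᵇ 2} e)))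

binary-last : ∀ s k → binary (s ++ [ k ]) ≡ true → k <?ᵇ 2 ≡ true
binary-last []      k e = proj₁ (∧-true⁻ {k <?ᵇ 2} e)
binary-last (x ∷ s) k e = binary-last s k (proj₂ (∧-true⁻ {x <?ᵇ 2} e))

binary-snoc : ∀ s k → binary s ≡ true → k < 2 → binary (s ++ [ k ]) ≡ true
binary-snoc []      k e k<2 = cong₂ _∧_ (<?ᵇ-complete k<2) refl
binary-snoc (x ∷ s) k e k<2 =
  cong₂ _∧_ (proj₁ (∧-true⁻ {x <?ᵇ 2} e)) (binary-snoc s k (proj₂ (∧-true⁻ {x <?ᵇ 2} e)) k<2)

binaryFan : Fan
binaryFan = record
  { spread     = record
    { node      = binary
    ; root      = refl
    ; prefix-cl = binary-prefix
    ; has-succ  = λ s e → 0 , binary-snoc s 0 e (N.s≤s N.z≤n)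
    }
  ; fin-branch = λ s e → 2 , λ k e' → <?ᵇ-sound k 2 (binary-last s k e')
  }

entry : List ℕ → ℕ → ℕ
entry []      j       = 0
entry (x ∷ s) zero    = x
entry (x ∷ s) (suc j) = entry s j

entry-path : ∀ s → binary s ≡ true → IsPath (spread binaryFan) (entry s)
entry-path s e n = all-initSeg (entry s) (entry-binary s e) (L.upTo n)
  where
    entry-binary : ∀ s → binary s ≡ true → ∀ j → entry s j <?ᵇ 2 ≡ true
    entry-binary []      e j       = refl
    entry-binary (x ∷ s) e zero    = proj₁ (∧-true⁻ {x <?ᵇ 2} e)
    entry-binary (x ∷ s) e (suc j) = entry-binary s (proj₂ (∧-true⁻ {x <?ᵇ 2} e)) j

    all-initSeg : ∀ (α : ℕ → ℕ) → (∀ j → α j <?ᵇ 2 ≡ true) → ∀ l → binary (L.map α l) ≡ true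
    all-initSeg α h []      = refl
    all-initSeg α h (x ∷ l) = cong₂ _∧_ (h x) (all-initSeg α h l)

entry-initSeg : ∀ (α : ℕ → ℕ) n j → j < n → entry (initSeg α n) j ≡ α j
entry-initSeg α n = entry-applyUpTo id n
  where
    entry-applyUpTo : ∀ (f : ℕ → ℕ) n j → j < n → entry (L.map α (L.applyUpTo f n)) j ≡ α (f j)
    entry-applyUpTo f (suc n) zero    lt = refl
    entry-applyUpTo f (suc n) (suc j) lt = entry-applyUpTo (f ∘ suc) n j (N.s≤s⁻¹ lt)

length-initSeg : ∀ (α : ℕ → ℕ) n → L.length (initSeg α n) ≡ n
length-initSeg α n = trans (LP.length-map α (L.upTo n)) (LP.length-upTo n)

entry-snoc : ∀ s c j → j < L.length s → entry (s ++ [ c ]) j ≡ entry s j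
entry-snoc (x ∷ s) c zero    lt = refl
entry-snoc (x ∷ s) c (suc j) lt = entry-snoc s c j (N.s≤s⁻¹ lt)

entry-last : ∀ s c → entry (s ++ [ c ]) (L.length s) ≡ c
entry-last []      c = refl
entry-last (x ∷ s) c = entry-last s c

length-snoc : ∀ (s : List ℕ) c → L.length (s ++ [ c ]) ≡ suc (L.length s)
length-snoc []      c = refl
length-snoc (x ∷ s) c = cong suc (length-snoc s c)

module Completeness (T : Theory) (eR : Enumerable (Rel (sig T)))
                    (eA : EnumerableSubset {PCSeq (sig T)} (Axiom T))
                    (m : ℕ) (φ ψ : PC (sig T) m) where

  Sg : Signature
  Sg = sig T

  open Syntax {Sg}
  module Axioms = EnumerableSubset eA

  Derives : ∀ {n} → List (Fm Sg n) → Fm Sg n → Set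
  Derives = Deriv (Axiom T)

  -- A state has K names, represented in derivations by the variables
  -- Fin K.  It records facts (atomic formulas over the names) and pending
  -- positive formulas instantiated at names, still to be decomposed.
  data Fact (K : ℕ) : Set where
    frel : (R : Rel Sg) → Vec (Fin K) (arity Sg R) → Fact K
    feq  : Fin K → Fin K → Fact K

  data Item (K : ℕ) : Set where
    fact    : Fact K → Item K
    pending : (k : ℕ) → PC Sg k → Vec (Fin K) k → Item K

  factFm : ∀ {K} → Fact K → Fm Sg K
  factFm (frel R xs) = rel R xs
  factFm (feq i j)   = i ≐ j

  itemFm : ∀ {K} → Item K → Fm Sg K
  itemFm (fact f)        = factFm f
  itemFm (pending k χ v) = ren (V.lookup v) ⌜ χ ⌝

  wkFact : ∀ {K} → Fact K → Fact (suc K)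
  wkFact (frel R xs) = frel R (V.map suc xs)
  wkFact (feq i j)   = feq (suc i) (suc j)

  wkItem : ∀ {K} → Item K → Item (suc K)
  wkItem (fact f)        = fact (wkFact f)
  wkItem (pending k χ v) = pending k χ (V.map suc v)

  -- Facts named by levels rather than variables.  These atoms are stable
  -- under adding names, so they describe the growing model along a run.
  data Atom : Set where
    arel : (R : Rel Sg) → Vec ℕ (arity Sg R) → Atom
    aeq  : ℕ → ℕ → Atom

  arel-injective : ∀ {R R' a b} → arel R a ≡ arel R' b → Σ (R ≡ R') λ { refl → a ≡ b }
  arel-injective refl = refl , refl

  aeq-injective : ∀ {a b c d} → aeq a b ≡ aeq c d → a ≡ c × b ≡ d
  aeq-injective refl = refl , refl

  _≟ᵃ_ : (x y : Atom) → Dec (x ≡ y)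
  arel R xs ≟ᵃ arel R' ys with enumerable-≟ eR R R'
  ... | no ne = no λ { refl → ne refl }
  ... | yes refl with VP.≡-dec NP._≟_ xs ys
  ...   | yes refl = yes refl
  ...   | no ne    = no λ { refl → ne refl }
  arel R xs ≟ᵃ aeq a b   = no λ ()
  aeq a b   ≟ᵃ arel R ys = no λ ()
  aeq a b   ≟ᵃ aeq c d with a NP.≟ c | b NP.≟ d
  ... | yes refl | yes refl = yes refl
  ... | no ne    | _        = no λ { refl → ne refl }
  ... | yes _    | no ne    = no λ { refl → ne refl }

  open import Data.List.Membership.DecPropositional _≟ᵃ_ using (_∈?_)

  recorded : Atom → List Atom → Bool
  recorded x l = ⌊ x ∈? l ⌋

  atomOf : ∀ {K} → Fact K → Atom
  atomOf (frel R xs) = arel R (V.map level xs)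
  atomOf (feq i j)   = aeq (level i) (level j)

  facts : ∀ {K} → List (Item K) → List (Fact K)
  facts []                  = []
  facts (fact f ∷ is)       = f ∷ facts is
  facts (pending _ _ _ ∷ is) = facts is

  atoms : ∀ {K} → List (Item K) → List Atom
  atoms is = L.map atomOf (facts is)

  -- Decidable truth of a positive formula in a finite set of atoms, with
  -- quantifiers ranging over the names c with c = c recorded.
  existing : List Atom → List ℕ
  existing []             = []
  existing (arel _ _ ∷ l) = existing l
  existing (aeq a b ∷ l) with a NP.≟ b
  ... | yes _ = a ∷ existing l
  ... | no _  = existing l

  holds : List Atom → ∀ {k} → PC Sg k → Vec ℕ k → Bool
  holds A (rel R ts) v = recorded (arel R (V.map (V.lookup v) ts)) A
  holds A (i ≐ j)    v = recorded (aeq (V.lookup v i) (V.lookup v j)) A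
  holds A ⊤ᶜ         v = true
  holds A (χ ∧ᶜ χ')  v = holds A χ v ∧ holds A χ' v
  holds A (χ ∨ᶜ χ')  v = holds A χ v ∨ holds A χ' v
  holds A (∃ᶜ χ)     v = any (λ c → holds A χ (c ∷ v)) (existing A)

  allExist : List Atom → ∀ {k} → Vec ℕ k → Bool
  allExist A []      = true
  allExist A (c ∷ v) = recorded (aeq c c) A ∧ allExist A v

  record State : Set where
    constructor state
    field
      K       : ℕ
      items   : List (Item K)
      generic : Vec (Fin K) m
  open State public

  initial : State
  initial = state m (pending m φ (V.allFin m) ∷ L.tabulate (λ i → fact (feq i i))) (V.allFin m)

  data Action (K : ℕ) : Set where
    add    : List (Item K) → Action K
    branch : Item K → Item K → Action K
    fresh  : (k : ℕ) → PC Sg (suc k) → Vec (Fin K) k → Action K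

  decompose : ∀ {K} → Item K → Action K
  decompose (pending k (rel R ts) v) = add [ fact (frel R (V.map (V.lookup v) ts)) ]
  decompose (pending k (i ≐ j) v)    = add [ fact (feq (V.lookup v i) (V.lookup v j)) ]
  decompose (pending k ⊤ᶜ v)         = add []
  decompose (pending k (χ ∧ᶜ χ') v)  = add (pending k χ v ∷ pending k χ' v ∷ [])
  decompose (pending k (χ ∨ᶜ χ') v)  = branch (pending k χ v) (pending k χ' v)
  decompose (pending k (∃ᶜ χ) v)     = fresh k χ v
  decompose (fact f)                 = add []

  symmetry : ∀ {K} → Item K → Action K
  symmetry (fact (feq i j)) = add [ fact (feq j i) ]
  symmetry _                = add []

  transitivity : ∀ {K} → Item K → Item K → Action K
  transitivity (fact (feq i j)) (fact (feq j' l)) with j F.≟ j'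
  ... | yes _ = add [ fact (feq i l) ]
  ... | no _  = add []
  transitivity _ _ = add []

  congruence : ∀ {K} → Item K → ℕ → Item K → Action K
  congruence (fact (frel R xs)) r (fact (feq i j)) with toFin (arity Sg R) r
  ... | nothing = add []
  ... | just r′ with V.lookup xs r′ F.≟ i
  ...   | yes _ = add [ fact (frel R (xs [ r′ ]≔ j)) ]
  ...   | no _  = add []
  congruence _ _ _ = add []

  variableOf : (K : ℕ) → ℕ → Maybe (Fin K)
  variableOf zero    c = nothing
  variableOf (suc K) c with c NP.≟ K
  ... | yes _ = just zero
  ... | no _  = Maybe.map suc (variableOf K c)

  variablesOf : ∀ {K k} → Vec ℕ k → Maybe (Vec (Fin K) k)
  variablesOf [] = just []
  variablesOf {K} (c ∷ v) with variableOf K c | variablesOf {K} v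
  ... | just i | just w = just (i ∷ w)
  ... | _      | _      = nothing

  fireAxiom : ∀ {K} → List (Item K) → PCSeq Sg → ℕ → Action K
  fireAxiom {K} is (k , φ' , ψ') code
    with variablesOf {K} (decodeVec k code)
       | allExist (atoms is) (decodeVec k code) ∧ holds (atoms is) φ' (decodeVec k code)
  ... | just w | true = add [ pending k ψ' w ]
  ... | _      | _    = add []

  fireEnumerated : ∀ {K} → List (Item K) → (a time code : ℕ) (b : Bool) → Axioms.f a time ≡ b → Action K
  fireEnumerated is a time code false _ = add []
  fireEnumerated is a time code true  e = fireAxiom is (Axioms.g a (time , e)) code

  tryAxiom : ∀ {K} → List (Item K) → (a time code : ℕ) → Action K
  tryAxiom is a time code = fireEnumerated is a time code (Axioms.f a time) refl

  -- The tasks of the search; positions refer to items of the state.  The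
  -- axiom task fires axiom number a, if enumerated by `time`, at the names
  -- whose levels are coded by `code`.
  data Task : Set where
    axiomTask : (a time code : ℕ) → Task
    decompTask symTask : (p : ℕ) → Task
    transTask : (p q : ℕ) → Task
    congTask  : (p r q : ℕ) → Task
    idle      : Task

  encodeTask : Task → ℕ
  encodeTask (axiomTask a time code) = ⟪ 0 , ⟪ a , ⟪ time , code ⟫ ⟫ ⟫
  encodeTask (decompTask p)          = ⟪ 1 , p ⟫
  encodeTask (symTask p)             = ⟪ 2 , p ⟫
  encodeTask (transTask p q)         = ⟪ 3 , ⟪ p , q ⟫ ⟫
  encodeTask (congTask p r q)        = ⟪ 4 , ⟪ p , ⟪ r , q ⟫ ⟫ ⟫
  encodeTask idle                    = ⟪ 5 , 0 ⟫

  decodeTask′ : ℕ × ℕ → Task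
  decodeTask′ (0 , c) = axiomTask (proj₁ (unpair c)) (proj₁ (unpair (proj₂ (unpair c))))
                                  (proj₂ (unpair (proj₂ (unpair c))))
  decodeTask′ (1 , p) = decompTask p
  decodeTask′ (2 , p) = symTask p
  decodeTask′ (3 , c) = transTask (proj₁ (unpair c)) (proj₂ (unpair c))
  decodeTask′ (4 , c) = congTask (proj₁ (unpair c)) (proj₁ (unpair (proj₂ (unpair c))))
                                 (proj₂ (unpair (proj₂ (unpair c))))
  decodeTask′ _       = idle

  decodeTask : ℕ → Task
  decodeTask n = decodeTask′ (unpair n)

  decodeTask-encodeTask : ∀ t → decodeTask (encodeTask t) ≡ t
  decodeTask-encodeTask (axiomTask a time code)
    rewrite unpair-pair 0 ⟪ a , ⟪ time , code ⟫ ⟫ | unpair-pair a ⟪ time , code ⟫ | unpair-pair time code = refl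
  decodeTask-encodeTask (decompTask p) rewrite unpair-pair 1 p = refl
  decodeTask-encodeTask (symTask p)    rewrite unpair-pair 2 p = refl
  decodeTask-encodeTask (transTask p q) rewrite unpair-pair 3 ⟪ p , q ⟫ | unpair-pair p q = refl
  decodeTask-encodeTask (congTask p r q)
    rewrite unpair-pair 4 ⟪ p , ⟪ r , q ⟫ ⟫ | unpair-pair p ⟪ r , q ⟫ | unpair-pair r q = refl
  decodeTask-encodeTask idle rewrite unpair-pair 5 0 = refl

  atPosition : ∀ {K} → List (Item K) → ℕ → (Item K → Action K) → Action K
  atPosition is p h = maybe h (add []) (is ‼ p)

  atPositions : ∀ {K} → List (Item K) → ℕ → ℕ → (Item K → Item K → Action K) → Action K
  atPositions is p q h with is ‼ p | is ‼ q
  ... | just x | just y = h x y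
  ... | _      | _      = add []

  perform : ∀ {K} → List (Item K) → Task → Action K
  perform is (axiomTask a time code) = tryAxiom is a time code
  perform is (decompTask p)          = atPosition is p decompose
  perform is (symTask p)             = atPosition is p symmetry
  perform is (transTask p q)         = atPositions is p q transitivity
  perform is (congTask p r q)        = atPositions is p q (λ x y → congruence x r y)
  perform is idle                    = add []

  -- Stage j performs the task coded by the first component of j, so task t
  -- is performed at every stage ⟪ encodeTask t , n ⟫, which is ≥ n.
  action : (j : ℕ) (s : State) → Action (K s)
  action j s = perform (items s) (decodeTask (proj₁ (unpair j)))

  action-scheduled : ∀ t n s → action ⟪ encodeTask t , n ⟫ s ≡ perform (items s) t
  action-scheduled t n s rewrite unpair-pair (encodeTask t) n | decodeTask-encodeTask t = refl

  pick : ∀ {A : Set} → ℕ → A → A → A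
  pick zero    x y = x
  pick (suc _) x y = y

  step : (s : State) → Action (K s) → ℕ → State
  step (state K is g) (add new)      c = state K (is ++ new) g
  step (state K is g) (branch x y)   c = state K (is ++ [ pick c x y ]) g
  step (state K is g) (fresh k χ v)  c =
    state (suc K) (L.map wkItem is ++ pending (suc k) χ (zero ∷ V.map suc v) ∷ fact (feq zero zero) ∷ [])
          (V.map suc g)

  run : (ℕ → ℕ) → ℕ → State
  run α zero    = initial
  run α (suc n) = step (run α n) (action n (run α n)) (α n)

  recorded-sound : ∀ x l → recorded x l ≡ true → x ∈ l
  recorded-sound x l e with x ∈? l
  ... | yes p = p

  recorded-complete : ∀ {x l} → x ∈ l → recorded x l ≡ true
  recorded-complete {x} {l} p with x ∈? l
  ... | yes _ = refl
  ... | no ¬p = ⊥-elim (¬p p)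

  atomOf-injective : ∀ {K} (f g : Fact K) → atomOf f ≡ atomOf g → f ≡ g
  atomOf-injective (frel R xs) (frel R' ys) e with arel-injective e
  ... | refl , e' = cong (frel R) (levels-injective e')
  atomOf-injective (feq i j) (feq i' j') e with aeq-injective e
  ... | e₁ , e₂ = cong₂ feq (level-injective e₁) (level-injective e₂)
  atomOf-injective (frel R xs) (feq i j) ()
  atomOf-injective (feq i j) (frel R xs) ()

  facts-∈ : ∀ {K} (is : List (Item K)) {f} → f ∈ facts is → fact f ∈ is
  facts-∈ (fact g ∷ is)        (here refl) = here refl
  facts-∈ (fact g ∷ is)        (there p)   = there (facts-∈ is p)
  facts-∈ (pending _ _ _ ∷ is) p           = there (facts-∈ is p)

  ∈-facts : ∀ {K} (is : List (Item K)) {f} → fact f ∈ is → f ∈ facts is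
  ∈-facts (fact g ∷ is)        (here refl) = here refl
  ∈-facts (fact g ∷ is)        (there p)   = there (∈-facts is p)
  ∈-facts (pending _ _ _ ∷ is) (there p)   = ∈-facts is p

  atom-source : ∀ {K} (is : List (Item K)) {x} → x ∈ atoms is → Σ (Fact K) λ f → fact f ∈ is × atomOf f ≡ x
  atom-source is p with ∈-map⁻ atomOf p
  ... | f , f∈ , refl = f , facts-∈ is f∈ , refl

  atom-∈ : ∀ {K} (is : List (Item K)) {f} → fact f ∈ is → atomOf f ∈ atoms is
  atom-∈ is p = ∈-map⁺ atomOf (∈-facts is p)

  existing-sound : ∀ l {c} → c ∈ existing l → aeq c c ∈ l
  existing-sound (arel _ _ ∷ l) p = there (existing-sound l p)
  existing-sound (aeq a b ∷ l) p with a NP.≟ b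
  existing-sound (aeq a .a ∷ l) (here refl) | yes refl = here refl
  existing-sound (aeq a .a ∷ l) (there p)   | yes refl = there (existing-sound l p)
  ... | no _ = there (existing-sound l p)

  existing-complete : ∀ l {c} → aeq c c ∈ l → c ∈ existing l
  existing-complete (arel _ _ ∷ l) (there p) = existing-complete l p
  existing-complete (aeq a b ∷ l) p with a NP.≟ b
  existing-complete (aeq a .a ∷ l) (here refl) | yes refl = here refl
  existing-complete (aeq a .a ∷ l) (there p)   | yes refl = there (existing-complete l p)
  existing-complete (aeq a b ∷ l)  (here refl) | no ne    = ⊥-elim (ne refl)
  existing-complete (aeq a b ∷ l)  (there p)   | no ne    = existing-complete l p

  any-sound : ∀ (f : ℕ → Bool) l → any f l ≡ true → Σ ℕ λ c → c ∈ l × f c ≡ true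
  any-sound f (x ∷ l) e with ∨-true⁻ {f x} e
  ... | inj₁ e′ = x , here refl , e′
  ... | inj₂ e′ with any-sound f l e′
  ...   | c , c∈ , e″ = c , there c∈ , e″

  any-complete : ∀ (f : ℕ → Bool) l {c} → c ∈ l → f c ≡ true → any f l ≡ true
  any-complete f (x ∷ l) (here refl) e = ∨-trueˡ e
  any-complete f (x ∷ l) (there p)   e = ∨-trueʳ {f x} (any-complete f l p e)

  existence-fact : ∀ {K} (is : List (Item K)) {c} → aeq c c ∈ atoms is →
                   Σ (Fin K) λ i → fact (feq i i) ∈ is × level i ≡ c
  existence-fact is p with atom-source is p
  ... | feq i j , i∈ , e with aeq-injective e
  ...   | e₁ , e₂ with level-injective {i = i} {j} (trans e₁ (sym e₂))
  ...     | refl = i , i∈ , e₁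

  context : (s : State) → List (Fm Sg (K s))
  context s = L.map itemFm (items s)

  goal : (s : State) → Fm Sg (K s)
  goal s = itemFm (pending m ψ (generic s))

  Solved : State → Set
  Solved s = Derives (context s) (goal s)

  assumption : ∀ {K} {is : List (Item K)} {it} → it ∈ is → Derives (L.map itemFm is) (itemFm it)
  assumption p = hyp (∈-map⁺ itemFm p)

  levels-lookup : ∀ {K k n} (w : Vec (Fin K) k) (ts : Vec (Fin k) n) →
                  V.map (V.lookup (V.map level w)) ts ≡ V.map level (V.map (V.lookup w) ts)
  levels-lookup w ts = trans (VP.map-cong (λ i → VP.lookup-map i level w) ts) (VP.map-∘ level (V.lookup w) ts)

  holds-sound : ∀ {K} (is : List (Item K)) {k} (χ : PC Sg k) (w : Vec (Fin K) k) →
                holds (atoms is) χ (V.map level w) ≡ true → Derives (L.map itemFm is) (ren (V.lookup w) ⌜ χ ⌝)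
  holds-sound is (rel R ts) w e with atom-source is (recorded-sound _ _ e)
  ... | f , f∈ , e′ with atomOf-injective f (frel R (V.map (V.lookup w) ts))
                           (trans e′ (cong (arel R) (levels-lookup w ts)))
  ...   | refl = assumption f∈
  holds-sound is (i ≐ j) w e with atom-source is (recorded-sound _ _ e)
  ... | f , f∈ , e′ with atomOf-injective f (feq (V.lookup w i) (V.lookup w j))
                           (trans e′ (cong₂ aeq (VP.lookup-map i level w) (VP.lookup-map j level w)))
  ...   | refl = assumption f∈
  holds-sound is ⊤ᶜ w e = ⊤I
  holds-sound is (χ ∧ᶜ χ') w e with ∧-true⁻ {holds (atoms is) χ _} e
  ... | e₁ , e₂ = ∧I (holds-sound is χ w e₁) (holds-sound is χ' w e₂)
  holds-sound is (χ ∨ᶜ χ') w e with ∨-true⁻ {holds (atoms is) χ _} e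
  ... | inj₁ e₁ = ∨I₁ (holds-sound is χ w e₁)
  ... | inj₂ e₂ = ∨I₂ (holds-sound is χ' w e₂)
  holds-sound is (∃ᶜ χ) w e with any-sound _ _ e
  ... | c , c∈ , e′ with existence-fact is (existing-sound _ c∈)
  ...   | i , i∈ , refl =
    ∃I i (subst (Derives _) (sym (sub-lift i w ⌜ χ ⌝)) (holds-sound is χ (i ∷ w) e′)) (assumption i∈)

  holds-monotone : ∀ {l l'} → (∀ {x} → x ∈ l → x ∈ l') →
                   ∀ {k} (χ : PC Sg k) v → holds l χ v ≡ true → holds l' χ v ≡ true
  holds-monotone sub (rel R ts) v e = recorded-complete (sub (recorded-sound _ _ e))
  holds-monotone sub (i ≐ j)    v e = recorded-complete (sub (recorded-sound _ _ e))
  holds-monotone sub ⊤ᶜ         v e = refl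
  holds-monotone {l} sub (χ ∧ᶜ χ') v e with ∧-true⁻ {holds l χ v} e
  ... | e₁ , e₂ = cong₂ _∧_ (holds-monotone sub χ v e₁) (holds-monotone sub χ' v e₂)
  holds-monotone {l} {l'} sub (χ ∨ᶜ χ') v e with ∨-true⁻ {holds l χ v} e
  ... | inj₁ e₁ = ∨-trueˡ (holds-monotone sub χ v e₁)
  ... | inj₂ e₂ = ∨-trueʳ {holds l' χ v} (holds-monotone sub χ' v e₂)
  holds-monotone {l} {l'} sub (∃ᶜ χ) v e with any-sound _ _ e
  ... | c , c∈ , e′ = any-complete (λ c → holds l' χ (c ∷ v)) (existing l')
                        (existing-complete l' (sub (existing-sound l c∈))) (holds-monotone sub χ (c ∷ v) e′)

  allExist-monotone : ∀ {l l'} → (∀ {x} → x ∈ l → x ∈ l') →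
                      ∀ {k} (v : Vec ℕ k) → allExist l v ≡ true → allExist l' v ≡ true
  allExist-monotone sub []      e = refl
  allExist-monotone {l} sub (c ∷ v) e with ∧-true⁻ {recorded (aeq c c) l} e
  ... | e₁ , e₂ = cong₂ _∧_ (recorded-complete (sub (recorded-sound _ _ e₁))) (allExist-monotone sub v e₂)

  allExist-sound : ∀ {K} (is : List (Item K)) {k} (w : Vec (Fin K) k) →
                   allExist (atoms is) (V.map level w) ≡ true → ∀ i → Derives (L.map itemFm is) (E (V.lookup w i))
  allExist-sound is (x ∷ w) e zero with ∧-true⁻ {recorded (aeq (level x) (level x)) (atoms is)} e
  ... | e₁ , _ with existence-fact is (recorded-sound _ _ e₁)
  ...   | i , i∈ , eᵢ with level-injective {i = i} {x} eᵢ
  ...     | refl = assumption i∈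
  allExist-sound is (x ∷ w) e (suc i) =
    allExist-sound is w (proj₂ (∧-true⁻ {recorded (aeq (level x) (level x)) (atoms is)} e)) i

  Justified : ∀ {K} → List (Item K) → Action K → Set
  Justified is (add new)     = ∀ {it} → it ∈ new → Derives (L.map itemFm is) (itemFm it)
  Justified is (branch x y)  = Derives (L.map itemFm is) (itemFm x ∨ᶠ itemFm y)
  Justified is (fresh k χ v) = Derives (L.map itemFm is) (itemFm (pending k (∃ᶜ χ) v))

  nothing-added : ∀ {K} {is : List (Item K)} → Justified is (add [])
  nothing-added ()

  one-added : ∀ {K} {is : List (Item K)} {it} → Derives (L.map itemFm is) (itemFm it) → Justified is (add [ it ])
  one-added d (here refl) = d

  decompose-justified : ∀ {K} (is : List (Item K)) it → it ∈ is → Justified is (decompose it)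
  decompose-justified is (pending k (rel R ts) v) p = one-added (assumption p)
  decompose-justified is (pending k (i ≐ j) v)    p = one-added (assumption p)
  decompose-justified is (pending k ⊤ᶜ v)         p = nothing-added
  decompose-justified is (pending k (χ ∧ᶜ χ') v)  p (here refl)         = ∧E₁ (assumption p)
  decompose-justified is (pending k (χ ∧ᶜ χ') v)  p (there (here refl)) = ∧E₂ (assumption p)
  decompose-justified is (pending k (χ ∨ᶜ χ') v)  p = assumption p
  decompose-justified is (pending k (∃ᶜ χ) v)     p = assumption p
  decompose-justified is (fact f)                 p = nothing-added

  symmetry-justified : ∀ {K} (is : List (Item K)) it → it ∈ is → Justified is (symmetry it)
  symmetry-justified is (fact (feq i j))   p = one-added (≐sym (assumption p))
  symmetry-justified is (fact (frel _ _))  p = nothing-added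
  symmetry-justified is (pending _ _ _)    p = nothing-added

  transitivity-justified : ∀ {K} (is : List (Item K)) it it' → it ∈ is → it' ∈ is → Justified is (transitivity it it')
  transitivity-justified is (fact (feq i j)) (fact (feq j' l)) p q with j F.≟ j'
  ... | yes refl = one-added (≐sub (suc i ≐ zero) (assumption q) (assumption p))
  ... | no _     = nothing-added
  transitivity-justified is (fact (feq i j)) (fact (frel _ _)) p q = nothing-added
  transitivity-justified is (fact (feq i j)) (pending _ _ _)   p q = nothing-added
  transitivity-justified is (fact (frel _ _)) _                p q = nothing-added
  transitivity-justified is (pending _ _ _)   _                p q = nothing-added

  fill-hole : ∀ {K n} (xs : Vec (Fin K) n) (r : Fin n) (s : Fin K) →
              V.map (sub₀ s) (V.map suc xs [ r ]≔ zero) ≡ xs [ r ]≔ s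
  fill-hole (x ∷ xs) zero    s = cong (s ∷_) (trans (sym (VP.map-∘ (sub₀ s) suc xs)) (VP.map-id xs))
  fill-hole (x ∷ xs) (suc r) s = cong (x ∷_) (fill-hole xs r s)

  -- from R(xs) and xs[r] = i, j derive R(xs[r ≔ j]) by substitution in
  -- the formula R(xs[r ≔ x₀])
  rel-substitution : ∀ {K} {Γ : List (Fm Sg K)} R (xs : Vec (Fin K) (arity Sg R)) r {i j} →
                     V.lookup xs r ≡ i → Derives Γ (rel R xs) → Derives Γ (i ≐ j) → Derives Γ (rel R (xs [ r ]≔ j))
  rel-substitution R xs r {i} {j} e dR dEq =
    subst (Derives _) (cong (rel R) (fill-hole xs r j))
      (≐sub (rel R (V.map suc xs [ r ]≔ zero)) dEq (subst (Derives _) (cong (rel R) xs≡) dR))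
    where xs≡ : xs ≡ V.map (sub₀ i) (V.map suc xs [ r ]≔ zero)
          xs≡ = trans (trans (sym (VP.[]≔-lookup xs r)) (cong (xs [ r ]≔_) e)) (sym (fill-hole xs r i))

  congruence-justified : ∀ {K} (is : List (Item K)) it r it' → it ∈ is → it' ∈ is → Justified is (congruence it r it')
  congruence-justified is (fact (frel R xs)) r (fact (feq i j)) p q with toFin (arity Sg R) r
  ... | nothing = nothing-added
  ... | just r′ with V.lookup xs r′ F.≟ i
  ...   | no _  = nothing-added
  ...   | yes e = one-added (rel-substitution R xs r′ e (assumption p) (assumption q))
  congruence-justified is (fact (frel R xs)) r (fact (frel _ _)) p q = nothing-added
  congruence-justified is (fact (frel R xs)) r (pending _ _ _)   p q = nothing-added
  congruence-justified is (fact (feq _ _))   r _                 p q = nothing-added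
  congruence-justified is (pending _ _ _)    r _                 p q = nothing-added

  variableOf-sound : ∀ K c {i} → variableOf K c ≡ just i → level i ≡ c
  variableOf-sound (suc K) c e with c NP.≟ K
  variableOf-sound (suc K) c refl | yes e′ = sym e′
  variableOf-sound (suc K) c e    | no _ with variableOf K c in e₂
  variableOf-sound (suc K) c refl | no _ | just j = variableOf-sound K c e₂

  variableOf-complete : ∀ {K} (i : Fin K) → variableOf K (level i) ≡ just i
  variableOf-complete {suc K} zero with K NP.≟ K
  ... | yes _ = refl
  ... | no ne = ⊥-elim (ne refl)
  variableOf-complete {suc K} (suc i) with level i NP.≟ K
  ... | yes e = ⊥-elim (NP.<-irrefl e (level< i))
  ... | no _ rewrite variableOf-complete i = refl

  variablesOf-sound : ∀ {K k} (v : Vec ℕ k) {w} → variablesOf {K} v ≡ just w → V.map level w ≡ v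
  variablesOf-sound [] refl = refl
  variablesOf-sound {K} (c ∷ v) e with variableOf K c in e₁ | variablesOf {K} v in e₂
  variablesOf-sound {K} (c ∷ v) refl | just i | just w =
    cong₂ _∷_ (variableOf-sound K c e₁) (variablesOf-sound v e₂)

  variablesOf-complete : ∀ {K k} (w : Vec (Fin K) k) → variablesOf {K} (V.map level w) ≡ just w
  variablesOf-complete [] = refl
  variablesOf-complete (i ∷ w) rewrite variableOf-complete i | variablesOf-complete w = refl

  fireAxiom-justified : ∀ {K} (is : List (Item K)) s → Axiom T s → (code : ℕ) → Justified is (fireAxiom is s code)
  fireAxiom-justified {K} is (k , φ' , ψ') isAxiom code
    with variablesOf {K} (decodeVec k code) in e₁
       | allExist (atoms is) (decodeVec k code) ∧ holds (atoms is) φ' (decodeVec k code) in e₂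
  ... | nothing | _     = nothing-added
  ... | just w  | false = nothing-added
  ... | just w  | true with ∧-true⁻ {allExist (atoms is) (V.map level w)}
                               (subst (λ v → allExist (atoms is) v ∧ holds (atoms is) φ' v ≡ true)
                                      (sym (variablesOf-sound (decodeVec k code) e₁)) e₂)
  ...   | exist , premise =
    one-added (⇒E (instantiate k (⌜ φ' ⌝ ⇒ ⌜ ψ' ⌝) (V.lookup w) (allExist-sound is w exist) (ax isAxiom))
                  (holds-sound is φ' w premise))

  tryAxiom-justified : ∀ {K} (is : List (Item K)) a time code → Justified is (tryAxiom is a time code)
  tryAxiom-justified is a time code = go (Axioms.f a time) refl
    where go : ∀ b (e : Axioms.f a time ≡ b) → Justified is (fireEnumerated is a time code b e)
          go false e = nothing-added
          go true  e = fireAxiom-justified is (Axioms.g a (time , e)) (Axioms.g-into a (time , e)) code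

  atPosition-justified : ∀ {K} (is : List (Item K)) p (h : Item K → Action K) →
                         (∀ x → x ∈ is → Justified is (h x)) → Justified is (atPosition is p h)
  atPosition-justified is p h hj with is ‼ p in e
  ... | just x  = hj x (‼-∈ is p e)
  ... | nothing = nothing-added

  atPositions-justified : ∀ {K} (is : List (Item K)) p q (h : Item K → Item K → Action K) →
                          (∀ x y → x ∈ is → y ∈ is → Justified is (h x y)) → Justified is (atPositions is p q h)
  atPositions-justified is p q h hj with is ‼ p in e₁ | is ‼ q in e₂
  ... | just x  | just y  = hj x y (‼-∈ is p e₁) (‼-∈ is q e₂)
  ... | just x  | nothing = nothing-added
  ... | nothing | _       = nothing-added

  perform-justified : ∀ {K} (is : List (Item K)) t → Justified is (perform is t)
  perform-justified is (axiomTask a time code) = tryAxiom-justified is a time code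
  perform-justified is (decompTask p)   = atPosition-justified is p decompose (decompose-justified is)
  perform-justified is (symTask p)      = atPosition-justified is p symmetry (symmetry-justified is)
  perform-justified is (transTask p q)  = atPositions-justified is p q transitivity (transitivity-justified is)
  perform-justified is (congTask p r q) = atPositions-justified is p q _ (λ x y → congruence-justified is x r y)
  perform-justified is idle             = nothing-added

  action-justified : ∀ j s → Justified (items s) (action j s)
  action-justified j s = perform-justified (items s) (decodeTask (proj₁ (unpair j)))

  itemFm-wk : ∀ {K} (it : Item K) → itemFm (wkItem it) ≡ wk (itemFm it)
  itemFm-wk (fact (frel R xs)) = refl
  itemFm-wk (fact (feq i j))   = refl
  itemFm-wk (pending k χ v)    =
    trans (ren-cong (λ i → VP.lookup-map i suc v) ⌜ χ ⌝) (sym (ren-∘ suc (V.lookup v) ⌜ χ ⌝))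

  itemFm-fresh : ∀ {K k} (χ : PC Sg (suc k)) (v : Vec (Fin K) k) →
                 itemFm (pending (suc k) χ (zero ∷ V.map suc v)) ≡ ren (lift (V.lookup v)) ⌜ χ ⌝
  itemFm-fresh χ v = ren-cong pointwise ⌜ χ ⌝
    where pointwise : ∀ i → V.lookup (zero ∷ V.map suc v) i ≡ lift (V.lookup v) i
          pointwise zero    = refl
          pointwise (suc i) = VP.lookup-map i suc v

  -- Backward soundness: a state whose two successors are solved is solved.
  -- Added items are cut, branches are joined by ∨E, and a fresh name is
  -- discharged by ∃E.
  backward : ∀ s (a : Action (K s)) → Justified (items s) a → Solved (step s a 0) → Solved (step s a 1) → Solved s
  backward (state K is g) (add new) ok d₀ d₁ = cutAll d₀ old-or-new
    where old-or-new : ∀ {γ} → γ ∈ L.map itemFm (is ++ new) → Derives (L.map itemFm is) γ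
          old-or-new p with ∈-map⁻ itemFm p
          ... | it , it∈ , refl with ∈-++⁻ is it∈
          ...   | inj₁ q = assumption q
          ...   | inj₂ q = ok q
  backward (state K is g) (branch x y) ok d₀ d₁ = ∨E ok (cutAll d₀ (old-or-chosen x)) (cutAll d₁ (old-or-chosen y))
    where old-or-chosen : ∀ c {γ} → γ ∈ L.map itemFm (is ++ [ c ]) → Derives (itemFm c ∷ L.map itemFm is) γ
          old-or-chosen c p with ∈-map⁻ itemFm p
          ... | it , it∈ , refl with ∈-++⁻ is it∈
          ...   | inj₁ q         = hyp (there (∈-map⁺ itemFm q))
          ...   | inj₂ (here refl) = hyp (here refl)
  backward (state K is g) (fresh k χ v) ok d₀ d₁ =
    ∃E ok (weaken witness-context (subst (Derives _) (itemFm-wk (pending m ψ g)) d₀))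
    where witness-context : ∀ {γ} →
            γ ∈ L.map itemFm (L.map wkItem is ++ pending (suc k) χ (zero ∷ V.map suc v) ∷ fact (feq zero zero) ∷ []) →
            γ ∈ (ren (lift (V.lookup v)) ⌜ χ ⌝ ∷ E zero ∷ L.map wk (L.map itemFm is))
          witness-context p with ∈-map⁻ itemFm p
          ... | it , it∈ , refl with ∈-++⁻ (L.map wkItem is) it∈
          ...   | inj₂ (here refl)         = here (itemFm-fresh χ v)
          ...   | inj₂ (there (here refl)) = there (here refl)
          ...   | inj₁ q with ∈-map⁻ wkItem q
          ...     | it' , it'∈ , refl =
            there (there (subst (_∈ _) (sym (itemFm-wk it')) (∈-map⁺ wk (∈-map⁺ itemFm it'∈))))

  itemFm-generic : ∀ (χ : PC Sg m) → itemFm (pending m χ (V.allFin m)) ≡ ⌜ χ ⌝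
  itemFm-generic χ = trans (ren-cong VP.lookup-allFin ⌜ χ ⌝) (ren-id ⌜ χ ⌝)

  initial-solved⇒provable : Solved initial → Provable T (m , φ , ψ)
  initial-solved⇒provable d = generalize m _ (⇒I (cutAll (subst (Derives _) (itemFm-generic ψ) d) from-hyps))
    where from-hyps : ∀ {γ} → γ ∈ context initial → Derives (⌜ φ ⌝ ∷ existCtx m) γ
          from-hyps (here refl) = hyp (here (itemFm-generic φ))
          from-hyps (there p) with ∈-map⁻ itemFm p
          ... | it , it∈ , refl with ∈-tabulate⁻ it∈
          ...   | i , refl = hyp (there (E∈existCtx i))

  atPosition-at : ∀ {K} (is : List (Item K)) {p x} (h : Item K → Action K) → is ‼ p ≡ just x → atPosition is p h ≡ h x
  atPosition-at is h e = cong (maybe h (add [])) e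

  atPositions-at : ∀ {K} (is : List (Item K)) {p q x y} (h : Item K → Item K → Action K) →
                   is ‼ p ≡ just x → is ‼ q ≡ just y → atPositions is p q h ≡ h x y
  atPositions-at is h e₁ e₂ rewrite e₁ | e₂ = refl

  transitivity-joins : ∀ {K} (i j l : Fin K) → transitivity (fact (feq i j)) (fact (feq j l)) ≡ add [ fact (feq i l) ]
  transitivity-joins i j l with j F.≟ j
  ... | yes _ = refl
  ... | no ne = ⊥-elim (ne refl)

  congruence-replaces : ∀ {K} R (xs : Vec (Fin K) (arity Sg R)) r j →
                        congruence (fact (frel R xs)) (toℕ r) (fact (feq (V.lookup xs r) j)) ≡ add [ fact (frel R (xs [ r ]≔ j)) ]
  congruence-replaces R xs r j rewrite toFin-toℕ r with V.lookup xs r F.≟ V.lookup xs r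
  ... | yes _ = refl
  ... | no ne = ⊥-elim (ne refl)

  axiom-fires : ∀ {K} (is : List (Item K)) a time (e : Axioms.f a time ≡ true) {k φ' ψ'} →
                Axioms.g a (time , e) ≡ (k , φ' , ψ') → (w : Vec (Fin K) k) →
                allExist (atoms is) (V.map level w) ≡ true → holds (atoms is) φ' (V.map level w) ≡ true →
                perform is (axiomTask a time (encodeVec (V.map level w))) ≡ add [ pending k ψ' w ]
  axiom-fires {K} is a time e {k} {φ'} {ψ'} ge w exist premise = begin
      fireEnumerated is a time code (Axioms.f a time) refl  ≡⟨ enumerated (Axioms.f a time) refl ⟩
      fireAxiom is (Axioms.g a (time , e)) code             ≡⟨ cong (λ s → fireAxiom is s code) ge ⟩
      fireAxiom is (k , φ' , ψ') code                       ≡⟨ fires ⟩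
      add [ pending k ψ' w ]                                ∎
    where
      open ≡-Reasoning
      code = encodeVec (V.map level w)

      enumerated : ∀ b (e′ : Axioms.f a time ≡ b) →
                   fireEnumerated is a time code b e′ ≡ fireAxiom is (Axioms.g a (time , e)) code
      enumerated true  e′ rewrite bool-uip e′ e = refl
      enumerated false e′ with () ← trans (sym e′) e

      fires : fireAxiom is (k , φ' , ψ') code ≡ add [ pending k ψ' w ]
      fires rewrite decodeVec-encodeVec (V.map level w) | variablesOf-complete {K} w | exist | premise = refl

  -- Persistence: a step keeps every item at its position, renamed along
  -- the new name if one is introduced, and adds its new items at the end.

  Tracks : ∀ {K K'} → Item K → Item K' → Set
  Tracks {K' = K'} (fact f)        it' = Σ (Fact K') λ f' → it' ≡ fact f' × atomOf f' ≡ atomOf f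
  Tracks {K' = K'} (pending k χ v) it' = Σ (Vec (Fin K') k) λ v' → it' ≡ pending k χ v' × V.map level v' ≡ V.map level v

  Tracks-refl : ∀ {K} (it : Item K) → Tracks it it
  Tracks-refl (fact f)        = f , refl , refl
  Tracks-refl (pending k χ v) = v , refl , refl

  Tracks-trans : ∀ {K K' K''} (a : Item K) (b : Item K') (c : Item K'') → Tracks a b → Tracks b c → Tracks a c
  Tracks-trans (fact f)        .(fact f')        c (f' , refl , e) (f'' , refl , e') = f'' , refl , trans e' e
  Tracks-trans (pending k χ v) .(pending k χ v') c (v' , refl , e) (v'' , refl , e') = v'' , refl , trans e' e

  Tracks-wk : ∀ {K} (it : Item K) → Tracks it (wkItem it)
  Tracks-wk (fact (frel R xs)) = frel R (V.map suc xs) , refl , cong (arel R) (levels-wk xs)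
  Tracks-wk (fact (feq i j))   = feq (suc i) (suc j) , refl , refl
  Tracks-wk (pending k χ v)    = V.map suc v , refl , levels-wk v

  Copy : State → ℕ → ∀ {K} → Item K → Set
  Copy s p it = Σ (Item (K s)) λ it' → items s ‼ p ≡ just it' × Tracks it it'

  step-keeps : ∀ s a c p {it} → items s ‼ p ≡ just it → Copy (step s a c) p it
  step-keeps (state K is g) (add new)     c p {it} e = it , ‼-++ is new p e , Tracks-refl it
  step-keeps (state K is g) (branch x y)  c p {it} e = it , ‼-++ is _ p e , Tracks-refl it
  step-keeps (state K is g) (fresh k χ v) c p {it} e =
    wkItem it , ‼-++ (L.map wkItem is) _ p (‼-map wkItem is p e) , Tracks-wk it

  step-keeps-atoms : ∀ s a c {x} → x ∈ atoms (items s) → x ∈ atoms (items (step s a c))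
  step-keeps-atoms s a c x∈ with atom-source (items s) x∈
  ... | f , f∈ , refl with ∈-‼ f∈
  ...   | p , e with step-keeps s a c p e
  ...     | .(fact f') , e' , f' , refl , ef =
    subst (_∈ atoms (items (step s a c))) ef (atom-∈ (items (step s a c)) (‼-∈ (items (step s a c)) p e'))

  step-adds-atom : ∀ s (a : Action (K s)) c new → a ≡ add new → ∀ {f} → fact f ∈ new → atomOf f ∈ atoms (items (step s a c))
  step-adds-atom s .(add new) c new refl p = atom-∈ (items s ++ new) (∈-++⁺ʳ (items s) p)

  step-adds-item : ∀ s (a : Action (K s)) c new → a ≡ add new → ∀ i {it} → new ‼ i ≡ just it →
                   Copy (step s a c) (L.length (items s) + i) it
  step-adds-item s .(add new) c new refl i {it} e = it , trans (‼-++-length (items s) new i) e , Tracks-refl it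

  step-chooses : ∀ s (a : Action (K s)) c x y → a ≡ branch x y → Copy (step s a c) (L.length (items s)) (pick c x y)
  step-chooses s .(branch x y) c x y refl =
    pick c x y ,
    trans (cong ((items s ++ [ pick c x y ]) ‼_) (sym (NP.+-identityʳ _))) (‼-++-length (items s) _ 0) ,
    Tracks-refl _

  step-adds-witness : ∀ s (a : Action (K s)) c k (χ : PC Sg (suc k)) v → a ≡ fresh k χ v →
                      Σ (Vec (Fin (K (step s a c))) (suc k)) λ w →
                        items (step s a c) ‼ L.length (items s) ≡ just (pending (suc k) χ w) ×
                        V.map level w ≡ K s ∷ V.map level v
  step-adds-witness s .(fresh k χ v) c k χ v refl =
    zero ∷ V.map suc v ,
    trans (cong ((L.map wkItem (items s) ++ _) ‼_)
                (trans (sym (NP.+-identityʳ _)) (cong (_+ 0) (sym (LP.length-map wkItem (items s))))))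
          (‼-++-length (L.map wkItem (items s)) _ 0) ,
    cong (K s ∷_) (levels-wk v)

  createsName : ∀ {K} → Action K → Bool
  createsName (fresh _ _ _) = true
  createsName _             = false

  fresh-exists : ∀ s (a : Action (K s)) c → createsName a ≡ true → aeq (K s) (K s) ∈ atoms (items (step s a c))
  fresh-exists s (fresh k χ v) c refl =
    atom-∈ (L.map wkItem (items s) ++ pending (suc k) χ (zero ∷ V.map suc v) ∷ fact (feq zero zero) ∷ [])
           (∈-++⁺ʳ (L.map wkItem (items s)) (there (here refl)))

  -- Fix the sequence α of branch choices.  By persistence the atoms
  -- recorded along α grow, and their union is the limit diagram.
  module Limit (α : ℕ → ℕ) where

    stage : ℕ → State
    stage = run α

    size : ℕ → ℕ
    size n = K (stage n)

    atomsAt : ℕ → List Atom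
    atomsAt n = atoms (items (stage n))

    keeps-for : ∀ d n p {it} → items (stage n) ‼ p ≡ just it → Copy (stage (d + n)) p it
    keeps-for zero    n p {it} e = it , e , Tracks-refl it
    keeps-for (suc d) n p {it} e with keeps-for d n p e
    ... | it' , e' , t' with step-keeps (stage (d + n)) (action (d + n) (stage (d + n))) (α (d + n)) p e'
    ...   | it'' , e'' , t'' = it'' , e'' , Tracks-trans it it' it'' t' t''

    persists : ∀ {n} n' p {it} → n ≤ n' → items (stage n) ‼ p ≡ just it → Copy (stage n') p it
    persists {n} n' p le e with keeps-for (n' ∸ n) n p e
    ... | r rewrite NP.m∸n+n≡m le = r

    atoms-grow : ∀ d n {x} → x ∈ atomsAt n → x ∈ atomsAt (d + n)
    atoms-grow zero    n p = p
    atoms-grow (suc d) n p = step-keeps-atoms (stage (d + n)) (action (d + n) (stage (d + n))) (α (d + n)) (atoms-grow d n p)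

    atoms-monotone : ∀ {n n'} → n ≤ n' → ∀ {x} → x ∈ atomsAt n → x ∈ atomsAt n'
    atoms-monotone {n} {n'} le p = subst (λ k → _ ∈ atomsAt k) (NP.m∸n+n≡m le) (atoms-grow (n' ∸ n) n p)

    Recorded : Atom → Set
    Recorded x = Σ ℕ λ n → x ∈ atomsAt n

    below-pairˡ : ∀ t n₁ n₂ → n₁ ≤ ⟪ t , n₁ + n₂ ⟫
    below-pairˡ t n₁ n₂ = NP.≤-trans (NP.m≤m+n n₁ n₂) (≤-pair t (n₁ + n₂))

    below-pairʳ : ∀ t n₁ n₂ → n₂ ≤ ⟪ t , n₁ + n₂ ⟫
    below-pairʳ t n₁ n₂ = NP.≤-trans (NP.m≤n+m n₂ n₁) (≤-pair t (n₁ + n₂))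

    added-atom : ∀ J new → action J (stage J) ≡ add new → ∀ {f} → fact f ∈ new → Recorded (atomOf f)
    added-atom J new e p = suc J , step-adds-atom (stage J) _ (α J) new e p

    added-item : ∀ J new → action J (stage J) ≡ add new → ∀ i {it} → new ‼ i ≡ just it →
                 Copy (stage (suc J)) (L.length (items (stage J)) + i) it
    added-item J new e = step-adds-item (stage J) _ (α J) new e

    chosen-item : ∀ J x y → action J (stage J) ≡ branch x y → Copy (stage (suc J)) (L.length (items (stage J))) (pick (α J) x y)
    chosen-item J x y e = step-chooses (stage J) _ (α J) x y e

    witness-item : ∀ J k (χ : PC Sg (suc k)) v → action J (stage J) ≡ fresh k χ v →
                   Σ (Vec (Fin (size (suc J))) (suc k)) λ w →
                     items (stage (suc J)) ‼ L.length (items (stage J)) ≡ just (pending (suc k) χ w) ×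
                     V.map level w ≡ size J ∷ V.map level v
    witness-item J k χ v e = step-adds-witness (stage J) _ (α J) k χ v e

    FactAt : ℕ → ℕ → Atom → Set
    FactAt n p x = Σ (Fact (size n)) λ f → items (stage n) ‼ p ≡ just (fact f) × atomOf f ≡ x

    located : ∀ {x n} → x ∈ atomsAt n → Σ ℕ λ p → ∀ n' → n ≤ n' → FactAt n' p x
    located {x} {n} x∈ with atom-source (items (stage n)) x∈
    ... | f , f∈ , refl with ∈-‼ f∈
    ...   | p , e = p , λ n' le → as-fact n' (persists n' p le e)
      where as-fact : ∀ n' → Copy (stage n') p (fact f) → FactAt n' p (atomOf f)
            as-fact _ (.(fact f') , e' , f' , refl , ef) = f' , e' , ef

    -- Fairness: the equality atoms of the limit are closed under symmetry
    -- and transitivity, and the relational atoms under congruence, because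
    -- the corresponding tasks are scheduled at arbitrarily late stages.
    recorded-sym : ∀ {a b} → Recorded (aeq a b) → Recorded (aeq b a)
    recorded-sym (n , x∈) with located x∈
    ... | p , later = fire (later late (≤-pair (encodeTask (symTask p)) n))
      where
        late = ⟪ encodeTask (symTask p) , n ⟫
        fire : ∀ {a b} → FactAt late p (aeq a b) → Recorded (aeq b a)
        fire (feq i j , e , refl) =
          added-atom late _ (trans (action-scheduled (symTask p) n (stage late)) (atPosition-at (items (stage late)) symmetry e)) (here refl)

    recorded-trans : ∀ {a b c} → Recorded (aeq a b) → Recorded (aeq b c) → Recorded (aeq a c)
    recorded-trans (n₁ , x₁) (n₂ , x₂) with located x₁ | located x₂
    ... | p , later₁ | q , later₂ = fire (later₁ late (below-pairˡ (encodeTask t) n₁ n₂)) (later₂ late (below-pairʳ (encodeTask t) n₁ n₂))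
      where
        t = transTask p q
        late = ⟪ encodeTask t , n₁ + n₂ ⟫
        fire : ∀ {a b c} → FactAt late p (aeq a b) → FactAt late q (aeq b c) → Recorded (aeq a c)
        fire (feq i j , e₁ , refl) (feq j' l , e₂ , e) with aeq-injective e
        ... | ej , refl with level-injective {i = j'} {j} ej
        ...   | refl = added-atom late _ fired (here refl)
          where fired = trans (action-scheduled t (n₁ + n₂) (stage late))
                              (trans (atPositions-at (items (stage late)) transitivity e₁ e₂) (transitivity-joins i j l))

    recorded-cong : ∀ {R} {xs : Vec ℕ (arity Sg R)} (r : Fin (arity Sg R)) {y} →
                    Recorded (arel R xs) → Recorded (aeq (V.lookup xs r) y) → Recorded (arel R (xs [ r ]≔ y))
    recorded-cong {R} r (n₁ , x₁) (n₂ , x₂) with located x₁ | located x₂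
    ... | p , later₁ | q , later₂ = fire (later₁ late (below-pairˡ (encodeTask t) n₁ n₂)) (later₂ late (below-pairʳ (encodeTask t) n₁ n₂))
      where
        t = congTask p (toℕ r) q
        late = ⟪ encodeTask t , n₁ + n₂ ⟫
        fire : ∀ {xs y} → FactAt late p (arel R xs) → FactAt late q (aeq (V.lookup xs r) y) → Recorded (arel R (xs [ r ]≔ y))
        fire (frel R xs , e₁ , refl) (feq i j , e₂ , e) with aeq-injective e
        ... | ei , refl with level-injective {i = V.lookup xs r} {i} (trans (sym (VP.lookup-map r level xs)) (sym ei))
        ...   | refl = subst (λ zs → Recorded (arel R zs)) (VP.map-[]≔ level xs r) (added-atom late _ fired (here refl))
          where fired = trans (action-scheduled t (n₁ + n₂) (stage late))
                              (trans (atPositions-at (items (stage late)) (λ x y → congruence x (toℕ r) y) e₁ e₂) (congruence-replaces R xs r j))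

    -- The elements of the limit model: codes c < m stand for the generic
    -- names, and m + j for the name introduced at stage j, if any.
    freshAt : ℕ → Bool
    freshAt j = createsName (action j (stage j))

    isElement : ℕ → Bool
    isElement c = c <?ᵇ m ∨ freshAt (c ∸ m)

    nameOf : ℕ → ℕ
    nameOf c = if c <?ᵇ m then c else size (c ∸ m)

    Element : Set
    Element = Σ ℕ λ c → isElement c ≡ true

    name : Element → ℕ
    name d = nameOf (proj₁ d)

    element-≡ : ∀ {c c'} (e : isElement c ≡ true) (e' : isElement c' ≡ true) → c ≡ c' → _≡_ {A = Element} (c , e) (c' , e')
    element-≡ e e' refl = cong (_ ,_) (bool-uip e e')

    generic-element : Fin m → Element
    generic-element i = level i , ∨-trueˡ (<?ᵇ-complete (level< i))

    generic-name : ∀ i → name (generic-element i) ≡ level i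
    generic-name i rewrite <?ᵇ-complete (level< {m} i) = refl

    fresh-element : ∀ j → freshAt j ≡ true → isElement (m + j) ≡ true
    fresh-element j e rewrite <?ᵇ-refute (NP.m+n≮m m j) | NP.m+n∸m≡n m j = e

    fresh-name : ∀ j → nameOf (m + j) ≡ size j
    fresh-name j rewrite <?ᵇ-refute (NP.m+n≮m m j) | NP.m+n∸m≡n m j = refl

    -- every element is recorded to exist: generic names from the start,
    -- fresh names from the stage after their creation
    element-exists : ∀ (d : Element) → Recorded (aeq (name d) (name d))
    element-exists (c , isE) with c <?ᵇ m in lt
    ... | true with level-surjective m c (<?ᵇ-sound c m lt)
    ...   | i , refl = 0 , atom-∈ (items initial) (there (∈-tabulate⁺ i))
    element-exists (c , isE) | false =
      suc (c ∸ m) , fresh-exists (stage (c ∸ m)) (action (c ∸ m) (stage (c ∸ m))) (α (c ∸ m)) isE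

    _≈_ : Element → Element → Set
    d ≈ d' = Recorded (aeq (name d) (name d'))

    ≈-isEquivalence : IsEquivalence _≈_
    ≈-isEquivalence = record { refl = λ {d} → element-exists d ; sym = recorded-sym ; trans = recorded-trans }

    RelHolds : (R : Rel Sg) → Vec Element (arity Sg R) → Set
    RelHolds R ys = Recorded (arel R (V.map name ys))

    RelHolds-update : ∀ R (zs : Vec Element (arity Sg R)) r y → V.lookup zs r ≈ y → RelHolds R zs → RelHolds R (zs [ r ]≔ y)
    RelHolds-update R zs r y e h =
      subst (λ xs → Recorded (arel R xs)) (sym (VP.map-[]≔ name zs r))
        (recorded-cong r h (subst (λ a → Recorded (aeq a (name y))) (sym (VP.lookup-map r name zs)) e))

    limit : Diagram Sg
    limit = record
      { D        = Element
      ; _~_      = _≈_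
      ; ~-equiv  = ≈-isEquivalence
      ; ⟦_⟧ᴿ     = RelHolds
      ; ⟦⟧ᴿ-cong = λ R → pointwise-by-updates (RelHolds R) (RelHolds-update R)
      }

    Pending : State → ℕ → ∀ {k} → PC Sg k → Vec ℕ k → Set
    Pending s p {k} χ ns = Σ (Vec (Fin (K s)) k) λ v → items s ‼ p ≡ just (pending k χ v) × V.map level v ≡ ns

    copy⇒pending : ∀ s {p k χ K'} {v : Vec (Fin K') k} → Copy s p (pending k χ v) → Pending s p χ (V.map level v)
    copy⇒pending s (.(pending _ _ v') , e , v' , refl , ev) = v' , e , ev

    pending-persists : ∀ n n' {p k} {χ : PC Sg k} {ns} → n ≤ n' → Pending (stage n) p χ ns → Pending (stage n') p χ ns
    pending-persists n n' le (v , e , refl) = copy⇒pending (stage n') (persists n' _ le e)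

    decompStage : ℕ → ℕ → ℕ
    decompStage n p = ⟪ encodeTask (decompTask p) , n ⟫

    decomposed : ∀ n p {k} {χ : PC Sg k} {ns} → Pending (stage n) p χ ns →
                 Σ (Vec (Fin (size (decompStage n p))) k) λ v →
                   action (decompStage n p) (stage (decompStage n p)) ≡ decompose (pending k χ v) × V.map level v ≡ ns
    decomposed n p pend with pending-persists n (decompStage n p) (≤-pair (encodeTask (decompTask p)) n) pend
    ... | v , e , ev =
      v , trans (action-scheduled (decompTask p) n (stage j₀)) (atPosition-at (items (stage j₀)) decompose e) , ev
      where j₀ = decompStage n p

    Names : ∀ {k} → (Fin k → Element) → Vec ℕ k → Set
    Names ρ ns = ∀ i → name (ρ i) ≡ V.lookup ns i

    names-map : ∀ {k K a} (ρ : Fin k → Element) (v : Vec (Fin K) k) (ts : Vec (Fin k) a) → Names ρ (V.map level v) →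
                V.map name (V.map ρ ts) ≡ V.map level (V.map (V.lookup v) ts)
    names-map ρ v ts nm = trans (sym (VP.map-∘ name ρ ts)) (trans (VP.map-cong nm ts) (levels-lookup v ts))

    names-lookup : ∀ {k K} (ρ : Fin k → Element) (v : Vec (Fin K) k) → Names ρ (V.map level v) →
                   ∀ i → name (ρ i) ≡ level (V.lookup v i)
    names-lookup ρ v nm i = trans (nm i) (VP.lookup-map i level v)

    realign : ∀ {k} (ρ : Fin k → Element) {ns ns'} → ns' ≡ ns → Names ρ ns → Names ρ ns'
    realign ρ refl nm = nm

    -- Truth lemma: every formula that is ever pending holds in the limit,
    -- since it is eventually decomposed and its parts become pending.
    pending-true : ∀ {k} (χ : PC Sg k) n p {ns} → Pending (stage n) p χ ns → (ρ : Fin k → Element) → Names ρ ns →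
                   ⟦ limit ⟧ χ ρ
    pending-true (rel R ts) n p pend ρ nm with decomposed n p pend
    ... | v , fired , ev =
      subst (λ xs → Recorded (arel R xs)) (sym (names-map ρ v ts (realign ρ ev nm))) (added-atom (decompStage n p) _ fired (here refl))
    pending-true (i ≐ j) n p pend ρ nm with decomposed n p pend
    ... | v , fired , ev =
      subst₂ (λ a b → Recorded (aeq a b)) (sym (names-lookup ρ v (realign ρ ev nm) i)) (sym (names-lookup ρ v (realign ρ ev nm) j))
             (added-atom (decompStage n p) _ fired (here refl))
    pending-true ⊤ᶜ n p pend ρ nm = tt
    pending-true (χ ∧ᶜ χ') n p pend ρ nm with decomposed n p pend
    ... | v , fired , ev =
      pending-true χ  (suc j₀) _ (copy⇒pending (stage (suc j₀)) (added-item j₀ _ fired 0 refl)) ρ (realign ρ ev nm) ,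
      pending-true χ' (suc j₀) _ (copy⇒pending (stage (suc j₀)) (added-item j₀ _ fired 1 refl)) ρ (realign ρ ev nm)
      where j₀ = decompStage n p
    pending-true (χ ∨ᶜ χ') n p pend ρ nm with decomposed n p pend
    ... | v , fired , ev = chosen (α j₀) (chosen-item j₀ _ _ fired)
      where
        j₀ = decompStage n p
        chosen : ∀ c → Copy (stage (suc j₀)) (L.length (items (stage j₀))) (pick c (pending _ χ v) (pending _ χ' v)) →
                 ⟦ limit ⟧ (χ ∨ᶜ χ') ρ
        chosen zero    cp = inj₁ (pending-true χ  (suc j₀) (L.length (items (stage j₀))) (copy⇒pending (stage (suc j₀)) cp) ρ (realign ρ ev nm))
        chosen (suc _) cp = inj₂ (pending-true χ' (suc j₀) (L.length (items (stage j₀))) (copy⇒pending (stage (suc j₀)) cp) ρ (realign ρ ev nm))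
    pending-true {k} (∃ᶜ χ) n p pend ρ nm with decomposed n p pend
    ... | v , fired , ev = witnessed (witness-item j₀ k χ v fired)
      where
        j₀ = decompStage n p
        witness : Element
        witness = m + j₀ , fresh-element j₀ (cong createsName fired)
        witness-names : Names (extend limit witness ρ) (size j₀ ∷ V.map level v)
        witness-names zero    = fresh-name j₀
        witness-names (suc i) = realign ρ ev nm i
        witnessed : (Σ (Vec (Fin (size (suc j₀))) (suc k)) λ w →
                       items (stage (suc j₀)) ‼ L.length (items (stage j₀)) ≡ just (pending (suc k) χ w) ×
                       V.map level w ≡ size j₀ ∷ V.map level v) →
                    ⟦ limit ⟧ (∃ᶜ χ) ρ
        witnessed pend′ = witness , pending-true χ (suc j₀) _ pend′ (extend limit witness ρ) witness-names

    namesOf : ∀ {k} → (Fin k → Element) → Vec ℕ k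
    namesOf ρ = V.tabulate (name ∘ ρ)

    namesOf-map : ∀ {k a} (ρ : Fin k → Element) (ts : Vec (Fin k) a) → V.map (V.lookup (namesOf ρ)) ts ≡ V.map name (V.map ρ ts)
    namesOf-map ρ ts = trans (VP.map-cong (VP.lookup∘tabulate (name ∘ ρ)) ts) (VP.map-∘ name ρ ts)

    eventually-holds : ∀ {k} (χ : PC Sg k) (ρ : Fin k → Element) → ⟦ limit ⟧ χ ρ → Σ ℕ λ n → holds (atomsAt n) χ (namesOf ρ) ≡ true
    eventually-holds (rel R ts) ρ (n , x) =
      n , recorded-complete (subst (λ xs → arel R xs ∈ atomsAt n) (sym (namesOf-map ρ ts)) x)
    eventually-holds (i ≐ j) ρ (n , x) =
      n , recorded-complete (subst₂ (λ a b → aeq a b ∈ atomsAt n)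
                              (sym (VP.lookup∘tabulate (name ∘ ρ) i)) (sym (VP.lookup∘tabulate (name ∘ ρ) j)) x)
    eventually-holds ⊤ᶜ ρ _ = 0 , refl
    eventually-holds (χ ∧ᶜ χ') ρ (t , t') with eventually-holds χ ρ t | eventually-holds χ' ρ t'
    ... | n₁ , e₁ | n₂ , e₂ =
      n₁ + n₂ , cong₂ _∧_ (holds-monotone (atoms-monotone (NP.m≤m+n n₁ n₂)) χ _ e₁)
                          (holds-monotone (atoms-monotone (NP.m≤n+m n₂ n₁)) χ' _ e₂)
    eventually-holds (χ ∨ᶜ χ') ρ (inj₁ t) with eventually-holds χ ρ t
    ... | n , e = n , ∨-trueˡ e
    eventually-holds (χ ∨ᶜ χ') ρ (inj₂ t) with eventually-holds χ' ρ t
    ... | n , e = n , ∨-trueʳ {holds (atomsAt n) χ (namesOf ρ)} e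
    eventually-holds (∃ᶜ χ) ρ (d , t) with eventually-holds χ (extend limit d ρ) t | element-exists d
    ... | n₁ , e₁ | n₂ , x₂ =
      n₁ + n₂ , any-complete _ (existing (atomsAt (n₁ + n₂)))
                  (existing-complete _ (atoms-monotone (NP.m≤n+m n₂ n₁) x₂))
                  (holds-monotone (atoms-monotone (NP.m≤m+n n₁ n₂)) χ _ e₁)

    eventually-exist : ∀ {k} (ρ : Fin k → Element) → Σ ℕ λ n → allExist (atomsAt n) (namesOf ρ) ≡ true
    eventually-exist {zero}  ρ = 0 , refl
    eventually-exist {suc k} ρ with element-exists (ρ zero) | eventually-exist (ρ ∘ suc)
    ... | n₁ , x₁ | n₂ , e₂ =
      n₁ + n₂ , cong₂ _∧_ (recorded-complete (atoms-monotone (NP.m≤m+n n₁ n₂) x₁))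
                          (allExist-monotone (atoms-monotone (NP.m≤n+m n₂ n₁)) (namesOf (ρ ∘ suc)) e₂)

    existing-variables : ∀ {K} (is : List (Item K)) {k} (ns : Vec ℕ k) → allExist (atoms is) ns ≡ true →
                         Σ (Vec (Fin K) k) λ w → V.map level w ≡ ns
    existing-variables is []       e = [] , refl
    existing-variables is (c ∷ ns) e with ∧-true⁻ {recorded (aeq c c) (atoms is)} e
    ... | e₁ , e₂ with existence-fact is (recorded-sound _ _ e₁) | existing-variables is ns e₂
    ...   | i , _ , refl | w , refl = i ∷ w , refl

    -- if the premise of an enumerated axiom is detected at ρ by stage n,
    -- the axiom fires later, its conclusion becomes pending, hence true
    axiom-applies : ∀ {k φ' ψ'} a time (e : Axioms.f a time ≡ true) → Axioms.g a (time , e) ≡ (k , φ' , ψ') →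
                    (ρ : Fin k → Element) (n : ℕ) → allExist (atomsAt n) (namesOf ρ) ≡ true →
                    holds (atomsAt n) φ' (namesOf ρ) ≡ true → ⟦ limit ⟧ ψ' ρ
    axiom-applies {k} {φ'} {ψ'} a time e ga ρ n exist premise =
      conclude (existing-variables (items (stage j₀)) (namesOf ρ) exist₀)
      where
        t  = axiomTask a time (encodeVec (namesOf ρ))
        j₀ = ⟪ encodeTask t , n ⟫
        exist₀   = allExist-monotone (atoms-monotone (≤-pair (encodeTask t) n)) (namesOf ρ) exist
        premise₀ = holds-monotone (atoms-monotone (≤-pair (encodeTask t) n)) φ' (namesOf ρ) premise
        conclude : (Σ (Vec (Fin (size j₀)) k) λ w → V.map level w ≡ namesOf ρ) → ⟦ limit ⟧ ψ' ρ
        conclude (w , ew) =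
          pending-true ψ' (suc j₀) _ (copy⇒pending (stage (suc j₀)) (added-item j₀ _ fired 0 refl)) ρ names
          where
            fired : action j₀ (stage j₀) ≡ add [ pending k ψ' w ]
            fired = trans (action-scheduled t n (stage j₀))
                      (subst (λ ns → perform (items (stage j₀)) (axiomTask a time (encodeVec ns)) ≡ add [ pending k ψ' w ]) ew
                        (axiom-fires (items (stage j₀)) a time e ga w
                          (subst (λ ns → allExist (atomsAt j₀) ns ≡ true) (sym ew) exist₀)
                          (subst (λ ns → holds (atomsAt j₀) φ' ns ≡ true) (sym ew) premise₀)))
            names : Names ρ (V.map level w)
            names i = trans (sym (VP.lookup∘tabulate (name ∘ ρ) i)) (cong (λ ns → V.lookup ns i) (sym ew))

    limit-isModel : IsModel T limit
    limit-isModel (k , φ' , ψ') isAxiom ρ premise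
      with eventually-holds φ' ρ premise | eventually-exist ρ | Axioms.g-onto (k , φ' , ψ') isAxiom
    ... | n₁ , h₁ | n₂ , e₂ | a , (time , e) , ga =
      axiom-applies a time e ga ρ (n₁ + n₂)
        (allExist-monotone (atoms-monotone (NP.m≤n+m n₂ n₁)) (namesOf ρ) e₂)
        (holds-monotone (atoms-monotone (NP.m≤m+n n₁ n₂)) φ' (namesOf ρ) h₁)

    -- Enumerability: elements are coded by their codes, and equality and
    -- relations are recorded at some stage, which is decidable per stage.
    decodeAs : ∀ c b → isElement c ≡ b → Maybe Element
    decodeAs c true  e = just (c , e)
    decodeAs c false e = nothing

    decodeAs-element : ∀ c b (e : isElement c ≡ b) (isE : isElement c ≡ true) → decodeAs c b e ≡ just (c , isE)
    decodeAs-element c true  e isE = cong just (element-≡ e isE refl)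
    decodeAs-element c false e isE with () ← trans (sym e) isE

    decodeAs-code : ∀ c b (e : isElement c ≡ b) {d} → decodeAs c b e ≡ just d → proj₁ d ≡ c
    decodeAs-code c true e refl = refl

    elementCoding : Coding Element
    elementCoding = record
      { code        = proj₁
      ; decode      = λ c → decodeAs c (isElement c) refl
      ; decode-code = λ { (c , isE) → decodeAs-element c _ refl isE }
      ; code-decode = λ c → decodeAs-code c _ refl
      }

    limit-enumerable : EnumerableDiagram limit
    limit-enumerable =
      coded-enumerable elementCoding (λ _ _ → true) (λ _ _ _ → tt) (λ _ _ → 0 , refl) ,
      coded-enumerable (pairCoding elementCoding elementCoding)
        (λ { (d , d') n → recorded (aeq (name d) (name d')) (atomsAt n) })
        (λ { (d , d') n e → n , recorded-sound _ _ e })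
        (λ { (d , d') (n , x) → n , recorded-complete x }) ,
      λ R → coded-enumerable (vecCoding elementCoding (arity Sg R))
              (λ ys n → recorded (arel R (V.map name ys)) (atomsAt n))
              (λ ys n e → n , recorded-sound _ _ e)
              (λ ys (n , x) → n , recorded-complete x)

  run-agree : ∀ α β n → (∀ j → j < n → α j ≡ β j) → run α n ≡ run β n
  run-agree α β zero    agree = refl
  run-agree α β (suc n) agree
    rewrite run-agree α β n (λ j lt → agree j (NP.m<n⇒m<1+n lt)) | agree n NP.≤-refl = refl

  runOf : List ℕ → State
  runOf s = run (entry s) (L.length s)

  runOf-snoc : ∀ s c → runOf (s ++ [ c ]) ≡ step (runOf s) (action (L.length s) (runOf s)) c
  runOf-snoc s c
    rewrite length-snoc s c | run-agree (entry (s ++ [ c ])) (entry s) (L.length s) (entry-snoc s c) | entry-last s c = refl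

  runOf-initSeg : ∀ α n → runOf (initSeg α n) ≡ run α n
  runOf-initSeg α n =
    trans (cong (run (entry (initSeg α n))) (length-initSeg α n)) (run-agree _ α n (entry-initSeg α n))

  genericNames : Vec ℕ m
  genericNames = V.map level (V.allFin m)

  generic-step : ∀ s (a : Action (K s)) c → V.map level (generic (step s a c)) ≡ V.map level (generic s)
  generic-step (state K is g) (add _)       c = refl
  generic-step (state K is g) (branch _ _)  c = refl
  generic-step (state K is g) (fresh _ _ _) c = levels-wk g

  generic-run : ∀ α n → V.map level (generic (run α n)) ≡ genericNames
  generic-run α zero    = refl
  generic-run α (suc n) = trans (generic-step (run α n) (action n (run α n)) (α n)) (generic-run α n)

  ψ-recorded : List ℕ → Bool
  ψ-recorded s = holds (atoms (items (runOf s))) ψ genericNames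

  module _ (valid : (M : Diagram Sg) → EnumerableDiagram M → IsModel T M → M ⊨ (m , φ , ψ)) where

    -- Along any α the limit is an enumerable model of T in which φ holds
    -- at the generic elements; by validity so does ψ, which is therefore
    -- recorded at some stage.
    ψ-recorded-bar : IsBar binaryFan ψ-recorded
    ψ-recorded-bar α _ =
      n , subst (λ st → holds (atoms (items st)) ψ genericNames ≡ true) (sym (runOf-initSeg α n)) detected
      where
        open Limit α

        generic-names : Names generic-element genericNames
        generic-names i =
          trans (generic-name i) (sym (trans (VP.lookup-map i level (V.allFin m)) (cong level (VP.lookup-allFin i))))

        φ-true : ⟦ limit ⟧ φ generic-element
        φ-true = pending-true φ 0 0 (V.allFin m , refl , refl) generic-element generic-names

        ψ-detected : Σ ℕ λ n → holds (atomsAt n) ψ (namesOf generic-element) ≡ true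
        ψ-detected = eventually-holds ψ generic-element (valid limit limit-enumerable limit-isModel generic-element φ-true)

        n : ℕ
        n = proj₁ ψ-detected

        detected : holds (atomsAt n) ψ genericNames ≡ true
        detected = subst (λ ns → holds (atomsAt n) ψ ns ≡ true)
                         (trans (VP.tabulate-cong generic-name) (VP.tabulate-allFin level)) (proj₂ ψ-detected)

    module _ (N : ℕ) (uniform : ∀ α → IsPath (spread binaryFan) α →
                                Σ ℕ λ n → n ≤ N × ψ-recorded (initSeg α n) ≡ true) where

      -- a node of depth N is solved: ψ was recorded at or before it
      solved-at-depth : ∀ s → binary s ≡ true → L.length s ≡ N → Solved (runOf s)
      solved-at-depth s bin len with uniform (entry s) (entry-path s bin)
      ... | n , n≤N , rec =
        holds-sound (items (runOf s)) ψ (generic (runOf s))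
          (subst (λ ns → holds (atoms (items (runOf s))) ψ ns ≡ true) (sym (generic-run (entry s) (L.length s)))
                 (holds-monotone (Limit.atoms-monotone (entry s) (subst (n ≤_) (sym len) n≤N)) ψ genericNames
                   (subst (λ st → holds (atoms (items st)) ψ genericNames ≡ true) (runOf-initSeg (entry s) n) rec)))

      solved-above : ∀ d s → binary s ≡ true → L.length s + d ≡ N → Solved (runOf s)
      solved-above zero    s bin len = solved-at-depth s bin (trans (sym (NP.+-identityʳ _)) len)
      solved-above (suc d) s bin len =
        backward (runOf s) (action (L.length s) (runOf s)) (action-justified (L.length s) (runOf s))
          (subst Solved (runOf-snoc s 0) (solved-above d (s ++ [ 0 ]) (binary-snoc s 0 bin (N.s≤s N.z≤n)) len′))
          (subst Solved (runOf-snoc s 1) (solved-above d (s ++ [ 1 ]) (binary-snoc s 1 bin (N.s≤s (N.s≤s N.z≤n))) len′))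
        where len′ : ∀ {c} → L.length (s ++ [ c ]) + d ≡ N
              len′ {c} = trans (cong (_+ d) (length-snoc s c)) (trans (sym (NP.+-suc _ d)) len)

    provable : FAN-D → Provable T (m , φ , ψ)
    provable fan with fan binaryFan ψ-recorded ψ-recorded-bar
    ... | N , uniform = initial-solved⇒provable (solved-above N uniform N [] refl refl)


proposition2p10 : FAN-D → (T : Theory) → EnumerableTheory T →
    (s : PCSeq (sig T)) →
    ((M : Diagram (sig T)) → EnumerableDiagram M → IsModel T M → M ⊨ s) →
    Provable T s
proposition2p10 fan T (enumRel , enumAxioms) (m , φ , ψ) valid =
  Completeness.provable T enumRel enumAxioms m φ ψ valid fan
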